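{- Let $G$ be a finite simple connected graph that is chordal, claw-free, and narrow. Then any labeling of $G$ produced by the Labeling Algorithm described below is closed.
   Context: A labeling of $G$ (with $n$ vertices) is a bijection $V(G)\to[n]$, identified with $V(G)=[n]$; it is closed if whenever $\{j,i\},\{i,k\}$ are distinct edges with either ($j>i$ and $k>i$) or ($j<i$ and $k<i$), then $\{j,k\}\in E(G)$. Chordal: every cycle of length at least $4$ has a chord. Claw-free: no induced subgraph isomorphic to $K_{1,3}$. $d(v,w)$ is shortest-path distance, $\mathrm{diam}(G)=\max_{v,w}d(v,w)$, and a longest shortest path is a shortest path joining two vertices at distance $\mathrm{diam}(G)$. Narrow: for every vertex $v$ and every longest shortest path $P$, either $v\in V(P)$ or $v$ is adjacent to a vertex of $P$. Labeling Algorithm: choose a vertex $v_0$ of minimal degree among all endpoints of longest shortest paths of $G$; label it $1$, let $J=\{v_0\}$, and let the next label be $i=2$. Then for $j=1,2,\dots,n$ in turn: let $S=N_G(j)\setminus J$ be the set of unlabeled neighbors of the vertex labeled $j$; while $S\neq\emptyset$, pick $v\in S$ minimizing $|N_G(v)\setminus J|$ over $S$ (ties broken arbitrarily), give $v$ the label $i$, increase $i$ by $1$, add $v$ to $J$ and remove $v$ from $S$. Here $N_G(v)$ is the set of neighbors of $v$. -}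

module Defs where

open import Data.Nat using (ℕ; zero; suc; _≤_; _<_)
open import Data.Fin using (Fin; toℕ; fromℕ) renaming (zero to fz)
open import Data.Fin.Properties using () renaming (_≟_ to _≟ᶠ_)
open import Data.List using (List; []; _∷_; _++_; [_]; length; filter; allFin)
open import Data.Product using (Σ; ∃; _×_; _,_)
open import Data.Sum using (_⊎_)
open import Function.Definitions using (Injective)
open import Relation.Nullary using (¬_; Dec; ¬?)
open import Relation.Nullary.Decidable using (_×-dec_)
open import Relation.Binary.PropositionalEquality using (_≡_; _≢_)

record Graph (n : ℕ) : Set₁ where
  field
    Adj    : Fin n → Fin n → Set
    adj?   : ∀ u v → Dec (Adj u v)
    sym    : ∀ {u v} → Adj u v → Adj v u
    irrefl : ∀ {u} → ¬ Adj u u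

data At {A : Set} : List A → ℕ → A → Set where
  at-here  : ∀ {x xs} → At (x ∷ xs) zero x
  at-there : ∀ {x y xs k} → At xs k y → At (x ∷ xs) (suc k) y

module _ {n : ℕ} (G : Graph n) where
  open Graph G
  open import Data.List.Membership.DecPropositional (_≟ᶠ_ {n}) using (_∈_; _∉_; _∈?_)

  -- Reach k u v : there is a walk from u to v of length at most k
  data Reach : ℕ → Fin n → Fin n → Set where
    here : ∀ {k u} → Reach k u u
    step : ∀ {k u w v} → Adj u w → Reach k w v → Reach (suc k) u v

  IsDist : Fin n → Fin n → ℕ → Set
  IsDist u v d = Reach d u v × (∀ m → Reach m u v → d ≤ m)

  IsDiam : ℕ → Set
  IsDiam d = (∃ λ u → ∃ λ v → IsDist u v d) × (∀ u v → Reach d u v)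

  Connected : Set
  Connected = ∀ u v → ∃ λ k → Reach k u v

  CycNext : ∀ {m} → Fin m → Fin m → Set
  CycNext {m} i j = suc (toℕ i) ≡ toℕ j ⊎ (suc (toℕ i) ≡ m × toℕ j ≡ 0)

  CycAdjPos : ∀ {m} → Fin m → Fin m → Set
  CycAdjPos i j = CycNext i j ⊎ CycNext j i

  IsCycle : ∀ {m} → (Fin m → Fin n) → Set
  IsCycle {m} c = Injective _≡_ _≡_ c × (∀ i j → CycNext i j → Adj (c i) (c j))

  Chordal : Set
  Chordal = ∀ m (c : Fin m → Fin n) → 4 ≤ m → IsCycle c →
            ∃ λ i → ∃ λ j → ¬ CycAdjPos i j × i ≢ j × Adj (c i) (c j)

  ClawFree : Set
  ClawFree = ∀ c a b d → Adj c a → Adj c b → Adj c d →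
             a ≢ b → a ≢ d → b ≢ d →
             Adj a b ⊎ Adj a d ⊎ Adj b d

  record LongestShortestPath : Set where
    field
      len  : ℕ
      pth  : Fin (suc len) → Fin n
      cons : ∀ (i j : Fin (suc len)) → suc (toℕ i) ≡ toℕ j → Adj (pth i) (pth j)
      dist : IsDist (pth fz) (pth (fromℕ len)) len
      diam : IsDiam len

  Narrow : Set
  Narrow = ∀ (v : Fin n) (P : LongestShortestPath) →
           let open LongestShortestPath P in
           ∃ λ i → pth i ≡ v ⊎ Adj v (pth i)

  IsLSPEndpoint : Fin n → Set
  IsLSPEndpoint v = ∃ λ (P : LongestShortestPath) →
    let open LongestShortestPath P in pth fz ≡ v ⊎ pth (fromℕ len) ≡ v

  deg : Fin n → ℕ
  deg v = length (filter (adj? v) (allFin n))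

  outdeg : List (Fin n) → Fin n → ℕ
  outdeg J v = length (filter (λ w → adj? v w ×-dec ¬? (w ∈? J)) (allFin n))

  -- States of the Labeling Algorithm: AlgState j L means that the algorithm is
  -- about to continue processing the vertex at (0-based) position j (label j+1),
  -- and L lists the labeled vertices in order of their labels (J = set of L).
  data AlgState : ℕ → List (Fin n) → Set where
    start : ∀ v₀ → IsLSPEndpoint v₀ →
            (∀ w → IsLSPEndpoint w → deg v₀ ≤ deg w) →
            AlgState 0 [ v₀ ]
    -- inner loop: S = N(u) \ J nonempty; pick v ∈ S minimizing |N(v) \ J|
    pick  : ∀ {j L u v} → AlgState j L → At L j u →
            Adj u v → v ∉ L →
            (∀ w → Adj u w → w ∉ L → outdeg L v ≤ outdeg L w) →
            AlgState j (L ++ [ v ])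
    -- S empty: move on to the next j
    next  : ∀ {j L u} → AlgState j L → At L j u →
            (∀ w → Adj u w → w ∈ L) →
            AlgState (suc j) L

  AlgOutput : List (Fin n) → Set
  AlgOutput L = AlgState n L

  -- the labeling given by L (vertex at position i gets label i+1) is closed
  ClosedOrder : List (Fin n) → Set
  ClosedOrder L = ∀ {i j k vi vj vk} → At L i vi → At L j vj → At L k vk →
                  j ≢ k → Adj vj vi → Adj vi vk →
                  (i < j × i < k) ⊎ (j < i × k < i) →
                  Adj vj vk

-- Let ℓ be the distance from the first labelled vertex v₀. The algorithm is a breadth-first search:
-- labels increase with ℓ, and each vertex v ≠ v₀ is labelled while processing its parent, its earliest
-- labelled neighbour (one level lower), parents of later vertices being labelled no earlier.
-- In a chordal, claw-free, narrow graph every level is a clique. On level 1 this uses the minimality of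
-- deg v₀: a vertex of level 1 without neighbours on level 2 would be an endpoint of a longest shortest
-- path of smaller degree. On higher levels it is by induction: a vertex on a longest shortest path from
-- v₀ is adjacent to everything on its level, since by narrowness every vertex is on or next to that path,
-- and otherwise a claw or an induced cycle of length 4 to 6 appears.
-- For closedness it then remains, for a before b on one level, to show that a's neighbours one level up
-- are b's (else b would have been picked instead of a, having fewer unlabelled neighbours, or there is a
-- claw), and that b's neighbours one level down are a's (by the monotonicity of parents).

module Submission where

open import Defs
open import Data.Nat using (ℕ; zero; suc; _+_; _∸_; _≤_; _<_; z≤n; s≤s; _≤?_; _<?_; _≟_)
open import Data.Nat.Properties
open import Data.Fin using (Fin; toℕ; fromℕ) renaming (zero to fz; suc to fs)
open import Data.Fin.Properties using (toℕ-fromℕ; toℕ<n; toℕ-injective; any?; pigeonhole) renaming (_≟_ to _≟ᶠ_)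
open import Data.List using (List; []; _∷_; _++_; [_]; length; filter; allFin; take; lookup)
open import Data.List.Properties using (length-++; filter-none)
open import Data.List.Relation.Unary.All as All using (All; []; _∷_)
open import Data.List.Relation.Unary.All.Properties using (All¬⇒¬Any)
open import Data.List.Relation.Unary.Any using (here; there)
open import Data.List.Relation.Unary.Unique.Propositional using (Unique; _∷_)
open import Data.List.Relation.Unary.Unique.Propositional.Properties using (allFin⁺)
open import Data.List.Membership.Propositional using (_∈_; _∉_)
open import Data.List.Membership.Propositional.Properties using (∈-allFin)
open import Data.Product using (Σ; ∃; _×_; _,_; proj₁; proj₂; swap)
open import Data.Sum using (_⊎_; inj₁; inj₂; [_,_]′) renaming (map to ⊎-map)
open import Data.Empty using (⊥; ⊥-elim)
open import Data.Unit using (⊤)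
open import Function using (_∘_)
open import Relation.Nullary using (¬_; ¬?; Dec; yes; no; contradiction)
open import Relation.Nullary.Decidable using (_⊎-dec_; _×-dec_)
open import Relation.Unary using (Pred; Decidable)
open import Relation.Binary using (DecidableEquality; tri<; tri≈; tri>)
open import Relation.Binary.PropositionalEquality hiding ([_])

module _ {A : Set} where

  At-functional : ∀ {L : List A} {i x y} → At L i x → At L i y → x ≡ y
  At-functional at-here at-here = refl
  At-functional (at-there p) (at-there q) = At-functional p q

  At⇒<length : ∀ {L : List A} {i x} → At L i x → i < length L
  At⇒<length at-here = s≤s z≤n
  At⇒<length (at-there p) = s≤s (At⇒<length p)

  At-++⁺ˡ : ∀ {L ys : List A} {i x} → At L i x → At (L ++ ys) i x
  At-++⁺ˡ at-here = at-here
  At-++⁺ˡ (at-there p) = at-there (At-++⁺ˡ p)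

  At-++⁻ˡ : ∀ {L ys : List A} {i x} → At (L ++ ys) i x → i < length L → At L i x
  At-++⁻ˡ {L = _ ∷ _} at-here _ = at-here
  At-++⁻ˡ {L = _ ∷ _} (at-there p) (s≤s i<l) = at-there (At-++⁻ˡ p i<l)

  At-snoc⁻ : ∀ (L : List A) {v i x} → At (L ++ [ v ]) i x → At L i x ⊎ (i ≡ length L × x ≡ v)
  At-snoc⁻ [] at-here = inj₂ (refl , refl)
  At-snoc⁻ (y ∷ L) at-here = inj₁ at-here
  At-snoc⁻ (y ∷ L) (at-there p) with At-snoc⁻ L p
  ... | inj₁ q = inj₁ (at-there q)
  ... | inj₂ (refl , e) = inj₂ (refl , e)

  At-lookup : ∀ (L : List A) (i : Fin (length L)) → At L (toℕ i) (lookup L i)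
  At-lookup (x ∷ L) fz = at-here
  At-lookup (x ∷ L) (fs i) = at-there (At-lookup L i)

  At⇒∈ : ∀ {L : List A} {i x} → At L i x → x ∈ L
  At⇒∈ at-here = here refl
  At⇒∈ (at-there p) = there (At⇒∈ p)

  ∈⇒At : ∀ {L : List A} {x} → x ∈ L → ∃ λ i → At L i x
  ∈⇒At (here refl) = 0 , at-here
  ∈⇒At (there p) with ∈⇒At p
  ... | i , q = suc i , at-there q

  At⇒∈-take : ∀ {L : List A} {q i x} → At L q x → q < i → x ∈ take i L
  At⇒∈-take at-here (s≤s _) = here refl
  At⇒∈-take (at-there p) (s≤s q<i) = there (At⇒∈-take p q<i)

  ∈-take⇒At : ∀ (L : List A) i {x} → x ∈ take i L → ∃ λ q → q < i × At L q x
  ∈-take⇒At (y ∷ L) (suc i) (here refl) = 0 , s≤s z≤n , at-here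
  ∈-take⇒At (y ∷ L) (suc i) (there p) with ∈-take⇒At L i p
  ... | q , q<i , a = suc q , s≤s q<i , at-there a

  take-++ : ∀ (L ys : List A) i → i ≤ length L → take i (L ++ ys) ≡ take i L
  take-++ L ys zero _ = refl
  take-++ (x ∷ L) ys (suc i) (s≤s p) = cong (x ∷_) (take-++ L ys i p)

  take-length-++ : ∀ (L ys : List A) → take (length L) (L ++ ys) ≡ L
  take-length-++ [] [] = refl
  take-length-++ [] (y ∷ ys) = refl
  take-length-++ (x ∷ L) ys = cong (x ∷_) (take-length-++ L ys)

module Counting {A : Set} where

  count : ∀ {p} {P : Pred A p} → Decidable P → List A → ℕ
  count P? xs = length (filter P? xs)

  module _ {p q} {P : Pred A p} {Q : Pred A q} (P? : Decidable P) (Q? : Decidable Q) where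

    count-mono : (∀ {x} → P x → Q x) → ∀ xs → count P? xs ≤ count Q? xs
    count-mono P⊆Q [] = z≤n
    count-mono P⊆Q (x ∷ xs) with P? x | Q? x
    ... | yes _  | yes _  = s≤s (count-mono P⊆Q xs)
    ... | yes px | no ¬qx = contradiction (P⊆Q px) ¬qx
    ... | no _   | yes _  = m≤n⇒m≤1+n (count-mono P⊆Q xs)
    ... | no _   | no _   = count-mono P⊆Q xs

    count-⊎-≤ : ∀ xs → count (λ x → P? x ⊎-dec Q? x) xs ≤ count P? xs + count Q? xs
    count-⊎-≤ [] = z≤n
    count-⊎-≤ (x ∷ xs) with P? x | Q? x
    ... | yes _ | yes _ = s≤s (≤-trans (count-⊎-≤ xs) (+-monoʳ-≤ _ (n≤1+n _)))
    ... | yes _ | no _  = s≤s (count-⊎-≤ xs)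
    ... | no _  | yes _ = ≤-trans (s≤s (count-⊎-≤ xs)) (≤-reflexive (sym (+-suc _ _)))
    ... | no _  | no _  = count-⊎-≤ xs

    count-⊎-disjoint : (∀ {x} → P x → ¬ Q x) → ∀ xs →
                       count (λ x → P? x ⊎-dec Q? x) xs ≡ count P? xs + count Q? xs
    count-⊎-disjoint disj [] = refl
    count-⊎-disjoint disj (x ∷ xs) with P? x | Q? x
    ... | yes px | yes qx = contradiction qx (disj px)
    ... | yes _  | no _   = cong suc (count-⊎-disjoint disj xs)
    ... | no _   | yes _  = trans (cong suc (count-⊎-disjoint disj xs)) (sym (+-suc _ _))
    ... | no _   | no _   = count-⊎-disjoint disj xs

  module _ (_≟_ : DecidableEquality A) where

    count-≟-unique : ∀ {k xs} → Unique xs → k ∈ xs → count (_≟ k) xs ≡ 1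
    count-≟-unique {k} {x ∷ xs} (x∉xs ∷ _) (here refl) with x ≟ x
    ... | yes _ = cong suc (cong length (filter-none (_≟ k) (All.map (_∘ sym) x∉xs)))
    ... | no x≢x = contradiction refl x≢x
    count-≟-unique {k} {x ∷ xs} (x∉xs ∷ u) (there k∈xs) with x ≟ k
    ... | yes refl = contradiction k∈xs (All¬⇒¬Any x∉xs)
    ... | no _ = count-≟-unique u k∈xs

module _ {n : ℕ} where
  open Counting

  count-extend : ∀ {p q} {P : Pred (Fin n) p} {Q : Pred (Fin n) q} (P? : Decidable P) (Q? : Decidable Q)
                 {u v w} → ¬ P u → ¬ P v → u ≢ v → (∀ {x} → P x ⊎ x ≡ u ⊎ x ≡ v → Q x ⊎ x ≡ w) →
                 suc (count P? (allFin n)) ≤ count Q? (allFin n)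
  count-extend {P = P} P? Q? {u} {v} {w} ¬Pu ¬Pv u≢v P∪uv⊆Q∪w = ≤-pred (begin
    2 + # P?                           ≡⟨ +-comm 2 (# P?) ⟩
    # P? + (1 + 1)                     ≡⟨ cong (# P? +_) (sym (cong₂ _+_ (one u) (one v))) ⟩
    # P? + (# (_≟ᶠ u) + # (_≟ᶠ v))     ≡⟨ cong (# P? +_) (sym (count-⊎-disjoint (_≟ᶠ u) (_≟ᶠ v) u≢v′ F)) ⟩
    # P? + # uv?                       ≡⟨ sym (count-⊎-disjoint P? uv? disjoint F) ⟩
    # (λ x → P? x ⊎-dec uv? x)         ≤⟨ count-mono _ (λ x → Q? x ⊎-dec (x ≟ᶠ w)) P∪uv⊆Q∪w F ⟩
    # (λ x → Q? x ⊎-dec (x ≟ᶠ w))      ≤⟨ count-⊎-≤ Q? (_≟ᶠ w) F ⟩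
    # Q? + # (_≟ᶠ w)                   ≡⟨ cong (# Q? +_) (one w) ⟩
    # Q? + 1                           ≡⟨ +-comm (# Q?) 1 ⟩
    1 + # Q?                           ∎)
    where
    open ≤-Reasoning
    F : List (Fin n)
    F = allFin n
    # : ∀ {r} {R : Pred (Fin n) r} → Decidable R → ℕ
    # R? = count R? F
    one : ∀ k → # (_≟ᶠ k) ≡ 1
    one k = count-≟-unique _≟ᶠ_ (allFin⁺ n) (∈-allFin k)
    uv? : Decidable (λ x → x ≡ u ⊎ x ≡ v)
    uv? x = (x ≟ᶠ u) ⊎-dec (x ≟ᶠ v)
    u≢v′ : ∀ {x} → x ≡ u → ¬ x ≡ v
    u≢v′ refl = u≢v
    disjoint : ∀ {x} → P x → ¬ (x ≡ u ⊎ x ≡ v)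
    disjoint Px (inj₁ refl) = ¬Pu Px
    disjoint Px (inj₂ refl) = ¬Pv Px

module Walks {n : ℕ} (G : Graph n) where
  open Graph G renaming (sym to adj-sym)

  adj⇒≢ : ∀ {x y} → Adj x y → x ≢ y
  adj⇒≢ a refl = irrefl a

  Apart : Fin n → Fin n → Set
  Apart x y = x ≢ y × ¬ Adj x y

  apart-sym : ∀ {x y} → Apart x y → Apart y x
  apart-sym (x≢y , ¬xy) = x≢y ∘ sym , ¬xy ∘ adj-sym

  equal-or-adjacent : ∀ {x y} → ¬ Apart x y → x ≡ y ⊎ Adj x y
  equal-or-adjacent {x} {y} ¬apart with x ≟ᶠ y | adj? x y
  ... | yes x≡y | _ = inj₁ x≡y
  ... | no _ | yes xy = inj₂ xy
  ... | no x≢y | no ¬xy = contradiction (x≢y , ¬xy) ¬apart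

  ≡⊎adj⇒adj : ∀ {x y} → x ≢ y → x ≡ y ⊎ Adj x y → Adj x y
  ≡⊎adj⇒adj x≢y (inj₁ x≡y) = contradiction x≡y x≢y
  ≡⊎adj⇒adj _ (inj₂ xy) = xy

  reach-weaken : ∀ {k m u v} → k ≤ m → Reach G k u v → Reach G m u v
  reach-weaken _ here = here
  reach-weaken (s≤s k≤m) (step a r) = step a (reach-weaken k≤m r)

  reach-snoc : ∀ {k u w v} → Reach G k u w → Adj w v → Reach G (suc k) u v
  reach-snoc here a = step a here
  reach-snoc (step b r) a = step b (reach-snoc r a)

  reach-sym : ∀ {k u v} → Reach G k u v → Reach G k v u
  reach-sym here = here
  reach-sym (step a r) = reach-snoc (reach-sym r) (adj-sym a)

  reach-trans : ∀ {k m u w v} → Reach G k u w → Reach G m w v → Reach G (k + m) u v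
  reach-trans {k} {m} here r = reach-weaken (m≤n+m m k) r
  reach-trans (step a r) s = step a (reach-trans r s)

  reach-zero : ∀ {u v} → Reach G 0 u v → u ≡ v
  reach-zero here = refl

  reach-one : ∀ {u v} → Reach G 1 u v → u ≡ v ⊎ Adj u v
  reach-one here = inj₁ refl
  reach-one (step a here) = inj₂ a

  reach? : ∀ k u v → Dec (Reach G k u v)
  reach? k u v with u ≟ᶠ v
  ... | yes refl = yes here
  reach? zero u v | no u≢v = no (u≢v ∘ reach-zero)
  reach? (suc k) u v | no u≢v with any? (λ w → adj? u w ×-dec reach? k w v)
  ... | yes (w , a , r) = yes (step a r)
  ... | no ¬step = no λ { here → u≢v refl ; (step a r) → ¬step (_ , a , r) }

  distance : ∀ {k u v} → Reach G k u v → ∃ (IsDist G u v)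
  distance {zero} r = 0 , r , λ _ _ → z≤n
  distance {suc k} {u} {v} r with reach? k u v
  ... | yes r′ = distance r′
  ... | no ¬r′ = suc k , r , minimal
    where
    minimal : ∀ m → Reach G m u v → suc k ≤ m
    minimal m r″ with suc k ≤? m
    ... | yes k<m = k<m
    ... | no k≮m = contradiction (reach-weaken (≤-pred (≰⇒> k≮m)) r″) ¬r′

  dist-unique : ∀ {u v d d′} → IsDist G u v d → IsDist G u v d′ → d ≡ d′
  dist-unique (r , min) (r′ , min′) = ≤-antisym (min _ r′) (min′ _ r)

  dist-sym : ∀ {u v d} → IsDist G u v d → IsDist G v u d
  dist-sym (r , min) = reach-sym r , λ k r′ → min k (reach-sym r′)

  -- Only vtx 0, …, vtx len matter.
  record Walk (len : ℕ) (u v : Fin n) : Set where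
    field
      vtx     : ℕ → Fin n
      vtx-0   : vtx 0 ≡ u
      vtx-len : vtx len ≡ v
      edge    : ∀ s → s < len → Adj (vtx s) (vtx (suc s))
  open Walk public

  walk-segment : ∀ {len u v} (W : Walk len u v) k s → s + k ≤ len → Reach G k (vtx W s) (vtx W (s + k))
  walk-segment W zero s _ rewrite +-identityʳ s = here
  walk-segment W (suc k) s s+k<len rewrite +-suc s k =
    step (edge W s (≤-trans (s≤s (m≤m+n s k)) s+k<len)) (walk-segment W k (suc s) s+k<len)

  walk⇒reach : ∀ {len u v} → Walk len u v → Reach G len u v
  walk⇒reach {len} W = subst₂ (Reach G len) (vtx-0 W) (vtx-len W) (walk-segment W len 0 ≤-refl)

  walk-[] : ∀ u → Walk 0 u u
  walk-[] u = record { vtx = λ _ → u ; vtx-0 = refl ; vtx-len = refl ; edge = λ _ () }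

  walk-∷ : ∀ {k x u v} → Adj x u → Walk k u v → Walk (suc k) x v
  walk-∷ {k} {x} a W = record { vtx = vtx′ ; vtx-0 = refl ; vtx-len = vtx-len W ; edge = edge′ }
    where
    vtx′ : ℕ → Fin n
    vtx′ zero = x
    vtx′ (suc s) = vtx W s
    edge′ : ∀ s → s < suc k → Adj (vtx′ s) (vtx′ (suc s))
    edge′ zero _ = subst (Adj x) (sym (vtx-0 W)) a
    edge′ (suc s) (s≤s s<k) = edge W s s<k

  reach⇒walk : ∀ {k u v} → Reach G k u v → ∃ λ m → m ≤ k × Walk m u v
  reach⇒walk {u = u} here = 0 , z≤n , walk-[] u
  reach⇒walk (step a r) with reach⇒walk r
  ... | m , m≤k , W = suc m , s≤s m≤k , walk-∷ a W

  walk-cast : ∀ {l l′ u v} → l ≡ l′ → Walk l u v → Walk l′ u v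
  walk-cast {v = v} e W = record
    { vtx = vtx W
    ; vtx-0 = vtx-0 W
    ; vtx-len = subst (λ k → vtx W k ≡ v) e (vtx-len W)
    ; edge = λ s s< → edge W s (subst (s <_) (sym e) s<) }

  walk-drop : ∀ {len u v} (W : Walk len u v) s → s ≤ len → Walk (len ∸ s) (vtx W s) v
  walk-drop {len} W s s≤len = record
    { vtx = λ i → vtx W (s + i)
    ; vtx-0 = cong (vtx W) (+-identityʳ s)
    ; vtx-len = trans (cong (vtx W) (m+[n∸m]≡n s≤len)) (vtx-len W)
    ; edge = λ i i< → subst (λ z → Adj (vtx W (s + i)) (vtx W z)) (sym (+-suc s i))
                        (edge W (s + i) (subst (s + i <_) (m+[n∸m]≡n s≤len) (+-monoʳ-< s i<))) }

  walk-++ : ∀ {a b u v w} → Walk a u v → Walk b v w → Walk (a + b) u w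
  walk-++ {a} {b} W₁ W₂ = record
    { vtx = glued
    ; vtx-0 = vtx-0 W₁
    ; vtx-len = trans (glued-≥ (m≤m+n a b)) (trans (cong (vtx W₂) (m+n∸m≡n a b)) (vtx-len W₂))
    ; edge = edge′ }
    where
    glued : ℕ → Fin n
    glued s with s ≤? a
    ... | yes _ = vtx W₁ s
    ... | no _ = vtx W₂ (s ∸ a)
    glued-≤ : ∀ {s} → s ≤ a → glued s ≡ vtx W₁ s
    glued-≤ {s} s≤a with s ≤? a
    ... | yes _ = refl
    ... | no s≰a = contradiction s≤a s≰a
    glued-≥ : ∀ {s} → a ≤ s → glued s ≡ vtx W₂ (s ∸ a)
    glued-≥ {s} a≤s with s ≤? a
    ... | no _ = refl
    ... | yes s≤a with ≤-antisym s≤a a≤s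
    ...   | refl = trans (vtx-len W₁) (trans (sym (vtx-0 W₂)) (cong (vtx W₂) (sym (n∸n≡0 s))))
    edge′ : ∀ s → s < a + b → Adj (glued s) (glued (suc s))
    edge′ s s< with ≤-<-connex a s
    ... | inj₂ s<a = subst₂ Adj (sym (glued-≤ (<⇒≤ s<a))) (sym (glued-≤ s<a)) (edge W₁ s s<a)
    ... | inj₁ a≤s = subst₂ Adj (sym (glued-≥ a≤s))
                       (sym (trans (glued-≥ (m≤n⇒m≤1+n a≤s)) (cong (vtx W₂) (+-∸-assoc 1 a≤s))))
                       (edge W₂ (s ∸ a) (+-cancelˡ-< a _ _ (subst (_< a + b) (sym (m+[n∸m]≡n a≤s)) s<)))

  walk-++-prefix : ∀ {a b u v w} (W₁ : Walk a u v) (W₂ : Walk b v w) {s} → s ≤ a →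
                   vtx (walk-++ W₁ W₂) s ≡ vtx W₁ s
  walk-++-prefix {a} W₁ W₂ {s} s≤a with s ≤? a
  ... | yes _ = refl
  ... | no s≰a = contradiction s≤a s≰a

  walk-reverse : ∀ {len u v} → Walk len u v → Walk len v u
  walk-reverse {len} W = record
    { vtx = λ s → vtx W (len ∸ s)
    ; vtx-0 = vtx-len W
    ; vtx-len = trans (cong (vtx W) (n∸n≡0 len)) (vtx-0 W)
    ; edge = edge′ }
    where
    edge′ : ∀ s → s < len → Adj (vtx W (len ∸ s)) (vtx W (len ∸ suc s))
    edge′ s s<len = subst (λ z → Adj (vtx W z) (vtx W (len ∸ suc s))) (sym (+-∸-assoc 1 s<len))
                      (adj-sym (edge W (len ∸ suc s) (∸-monoʳ-< (s≤s z≤n) s<len)))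

  record DiametralWalk (u : Fin n) : Set where
    field
      diam    : ℕ
      far     : Fin n
      walk    : Walk diam u far
      dist    : IsDist G u far diam
      is-diam : IsDiam G diam

  private
    clamp : ∀ l → ℕ → Fin (suc l)
    clamp zero s = fz
    clamp (suc l) zero = fz
    clamp (suc l) (suc s) = fs (clamp l s)

    toℕ-clamp : ∀ l s → s ≤ l → toℕ (clamp l s) ≡ s
    toℕ-clamp zero zero _ = refl
    toℕ-clamp (suc l) zero _ = refl
    toℕ-clamp (suc l) (suc s) (s≤s s≤l) = cong suc (toℕ-clamp l s s≤l)

  module _ {u : Fin n} (D : DiametralWalk u) where
    open DiametralWalk D

    diametral⇒lsp : LongestShortestPath G
    diametral⇒lsp = record
      { len = diam
      ; pth = vtx walk ∘ toℕ
      ; cons = λ i j e → subst (Adj (vtx walk (toℕ i)) ∘ vtx walk) e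
                           (edge walk (toℕ i) (subst (_≤ diam) (sym e) (≤-pred (toℕ<n j))))
      ; dist = subst₂ (λ a b → IsDist G a b diam) (sym (vtx-0 walk))
                 (sym (trans (cong (vtx walk) (toℕ-fromℕ diam)) (vtx-len walk))) dist
      ; diam = is-diam }

    diametral⇒endpoint : IsLSPEndpoint G u
    diametral⇒endpoint = diametral⇒lsp , inj₁ (vtx-0 walk)

    narrow-diametral : Narrow G → ∀ x → ∃ λ s → s ≤ diam × (vtx walk s ≡ x ⊎ Adj x (vtx walk s))
    narrow-diametral narrow x with narrow x diametral⇒lsp
    ... | i , near = toℕ i , ≤-pred (toℕ<n i) , near

  lsp⇒walk : (P : LongestShortestPath G) → let open LongestShortestPath P in
             Walk len (pth fz) (pth (fromℕ len))
  lsp⇒walk P = record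
    { vtx = pth ∘ clamp len
    ; vtx-0 = cong pth (toℕ-injective (toℕ-clamp len 0 z≤n))
    ; vtx-len = cong pth (toℕ-injective (trans (toℕ-clamp len len ≤-refl) (sym (toℕ-fromℕ len))))
    ; edge = λ s s<len → cons _ _
               (trans (cong suc (toℕ-clamp len s (<⇒≤ s<len))) (sym (toℕ-clamp len (suc s) s<len))) }
    where open LongestShortestPath P

  endpoint⇒diametral : ∀ {u} → IsLSPEndpoint G u → DiametralWalk u
  endpoint⇒diametral (P , inj₁ refl) = record
    { walk = lsp⇒walk P ; dist = dist ; is-diam = diam }
    where open LongestShortestPath P
  endpoint⇒diametral (P , inj₂ refl) = record
    { walk = walk-reverse (lsp⇒walk P) ; dist = dist-sym dist ; is-diam = diam }
    where open LongestShortestPath P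

module InducedCycles {n : ℕ} (G : Graph n) (chordal : Chordal G) where
  open Graph G renaming (sym to adj-sym)
  open Walks G using (adj⇒≢; Apart)

  InducedPath : List (Fin n) → Set
  InducedPath [] = ⊤
  InducedPath (x ∷ []) = ⊤
  InducedPath (x ∷ y ∷ zs) = Adj x y × All (Apart x) zs × InducedPath (y ∷ zs)

  induced-path-edge : ∀ {zs p a b} → InducedPath zs → At zs p a → At zs (suc p) b → Adj a b
  induced-path-edge {_ ∷ []} _ at-here (at-there ())
  induced-path-edge {_ ∷ _ ∷ _} (a , _) at-here (at-there at-here) = a
  induced-path-edge {_ ∷ _ ∷ _} (_ , _ , path) (at-there ap) (at-there bq) = induced-path-edge path ap bq

  induced-path-far : ∀ {zs p q a b} → InducedPath zs → At zs p a → At zs q b → suc p < q → Apart a b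
  induced-path-far {_ ∷ []} _ at-here (at-there ()) _
  induced-path-far {_ ∷ _ ∷ _} _ at-here (at-there at-here) (s≤s ())
  induced-path-far {_ ∷ _ ∷ _} (_ , far , _) at-here (at-there (at-there bq)) _ = All.lookup far (At⇒∈ bq)
  induced-path-far {_ ∷ _ ∷ _} (_ , _ , path) (at-there ap) (at-there bq) (s≤s p<q) =
    induced-path-far path ap bq p<q

  -- x y w mid… z is a chordless cycle of length ≥ 4: y … z is an induced path and x is adjacent to its ends only.
  no-induced-cycle : ∀ {x y w z} mid → Adj x y → Adj z x → All (Apart x) (w ∷ mid) →
                     InducedPath (y ∷ w ∷ mid ++ [ z ]) → ⊥
  no-induced-cycle {x} {y} {w} {z} mid xy zx x-far path = no-chord (chordal m c 4≤m (injective , cycle-edge))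
    where
    V : List (Fin n)
    V = x ∷ y ∷ w ∷ mid ++ [ z ]
    m : ℕ
    m = length V
    c : Fin m → Fin n
    c = lookup V

    4≤m : 4 ≤ m
    4≤m = s≤s (s≤s (s≤s (subst (1 ≤_) (sym (length-++ mid)) (m≤n+m 1 (length mid)))))

    at : ∀ i → At V (toℕ i) (c i)
    at = At-lookup V

    last-position : ∀ {p a} → At V p a → suc p ≡ m → a ≡ z
    last-position {p} ap e with At-snoc⁻ (x ∷ y ∷ w ∷ mid) ap
    ... | inj₂ (_ , a≡z) = a≡z
    ... | inj₁ ap′ = contradiction (trans e (length-++ (x ∷ y ∷ w ∷ mid)))
                       (<⇒≢ (subst (suc p <_) (+-comm 1 _) (s≤s (At⇒<length ap′))))

    far-apart : ∀ {p q a b} → At V p a → At V q b → suc p < q → ¬ (p ≡ 0 × suc q ≡ m) → Apart a b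
    far-apart at-here (at-there at-here) (s≤s ()) _
    far-apart {q = suc (suc q)} at-here (at-there (at-there bq)) _ not-wrap with At-snoc⁻ (w ∷ mid) bq
    ... | inj₁ bq′ = All.lookup x-far (At⇒∈ bq′)
    ... | inj₂ (refl , _) = contradiction (refl , cong (3 +_) (trans (+-comm 1 _) (sym (length-++ mid)))) not-wrap
    far-apart (at-there ap) (at-there bq) (s≤s p<q) _ = induced-path-far path ap bq p<q

    cycle-edge : ∀ i j → CycNext G i j → Adj (c i) (c j)
    cycle-edge i j (inj₁ e) = consecutive (at i) (subst (λ q → At V q (c j)) (sym e) (at j))
      where
      consecutive : ∀ {p a b} → At V p a → At V (suc p) b → Adj a b
      consecutive at-here (at-there at-here) = xy
      consecutive (at-there ap) (at-there bq) = induced-path-edge path ap bq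
    cycle-edge i j (inj₂ (e , j≡0)) =
      subst₂ Adj (sym (last-position (at i) e)) (At-functional at-here (subst (λ q → At V q (c j)) j≡0 (at j))) zx

    cycle-adj : ∀ {i j} → CycAdjPos G i j → Adj (c i) (c j)
    cycle-adj (inj₁ ij) = cycle-edge _ _ ij
    cycle-adj (inj₂ ji) = adj-sym (cycle-edge _ _ ji)

    ordered : ∀ i j → toℕ i < toℕ j → CycAdjPos G i j ⊎ Apart (c i) (c j)
    ordered i j i<j with suc (toℕ i) ≟ toℕ j | toℕ i ≟ 0 | suc (toℕ j) ≟ m
    ... | yes e | _ | _ = inj₁ (inj₁ (inj₁ e))
    ... | no _ | yes i≡0 | yes j-last = inj₁ (inj₂ (inj₂ (j-last , i≡0)))
    ... | no i+1≢j | yes i≡0 | no j-not-last =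
          inj₂ (far-apart (at i) (at j) (≤∧≢⇒< i<j i+1≢j) (j-not-last ∘ proj₂))
    ... | no i+1≢j | no i≢0 | _ = inj₂ (far-apart (at i) (at j) (≤∧≢⇒< i<j i+1≢j) (i≢0 ∘ proj₁))

    injective : ∀ {i j} → c i ≡ c j → i ≡ j
    injective {i} {j} e with <-cmp (toℕ i) (toℕ j)
    ... | tri≈ _ i≡j _ = toℕ-injective i≡j
    ... | tri< i<j _ _ = ⊥-elim ([ (λ ij → adj⇒≢ (cycle-adj ij) e) , (λ (c≢ , _) → c≢ e) ]′ (ordered i j i<j))
    ... | tri> _ _ j<i =
          ⊥-elim ([ (λ ji → adj⇒≢ (cycle-adj ji) (sym e)) , (λ (c≢ , _) → c≢ (sym e)) ]′ (ordered j i j<i))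

    no-chord : ¬ (∃ λ i → ∃ λ j → ¬ CycAdjPos G i j × i ≢ j × Adj (c i) (c j))
    no-chord (i , j , ¬ij , i≢j , chord) with <-cmp (toℕ i) (toℕ j)
    ... | tri≈ _ e _ = i≢j (toℕ-injective e)
    ... | tri< i<j _ _ = [ ¬ij , (λ (_ , ¬adj) → ¬adj chord) ]′ (ordered i j i<j)
    ... | tri> _ _ j<i = [ ¬ij ∘ [ inj₂ , inj₁ ]′ , (λ (_ , ¬adj) → ¬adj (adj-sym chord)) ]′ (ordered j i j<i)

  C4-free : ∀ {x₀ x₁ x₂ x₃} → Adj x₀ x₁ → Adj x₁ x₂ → Adj x₂ x₃ → Adj x₃ x₀ →
            Apart x₀ x₂ → Apart x₁ x₃ → ⊥
  C4-free {x₀} {x₁} {x₂} {x₃} a₀₁ a₁₂ a₂₃ a₃₀ p₀₂ p₁₃ =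
    no-induced-cycle {x₀} {x₁} {x₂} {x₃} [] a₀₁ a₃₀ (p₀₂ ∷ []) (a₁₂ , p₁₃ ∷ [] , a₂₃ , [] , _)

  C5-free : ∀ {x₀ x₁ x₂ x₃ x₄} → Adj x₀ x₁ → Adj x₁ x₂ → Adj x₂ x₃ → Adj x₃ x₄ → Adj x₄ x₀ →
            Apart x₀ x₂ → Apart x₀ x₃ → Apart x₁ x₃ → Apart x₁ x₄ → Apart x₂ x₄ → ⊥
  C5-free {x₀} {x₁} {x₂} {x₃} {x₄} a₀₁ a₁₂ a₂₃ a₃₄ a₄₀ p₀₂ p₀₃ p₁₃ p₁₄ p₂₄ =
    no-induced-cycle {x₀} {x₁} {x₂} {x₄} [ x₃ ] a₀₁ a₄₀ (p₀₂ ∷ p₀₃ ∷ [])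
      (a₁₂ , p₁₃ ∷ p₁₄ ∷ [] , a₂₃ , p₂₄ ∷ [] , a₃₄ , [] , _)

  C6-free : ∀ {x₀ x₁ x₂ x₃ x₄ x₅} → Adj x₀ x₁ → Adj x₁ x₂ → Adj x₂ x₃ → Adj x₃ x₄ → Adj x₄ x₅ → Adj x₅ x₀ →
            Apart x₀ x₂ → Apart x₀ x₃ → Apart x₀ x₄ → Apart x₁ x₃ → Apart x₁ x₄ → Apart x₁ x₅ →
            Apart x₂ x₄ → Apart x₂ x₅ → Apart x₃ x₅ → ⊥
  C6-free {x₀} {x₁} {x₂} {x₃} {x₄} {x₅} a₀₁ a₁₂ a₂₃ a₃₄ a₄₅ a₅₀ p₀₂ p₀₃ p₀₄ p₁₃ p₁₄ p₁₅ p₂₄ p₂₅ p₃₅ =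
    no-induced-cycle {x₀} {x₁} {x₂} {x₅} (x₃ ∷ x₄ ∷ []) a₀₁ a₅₀ (p₀₂ ∷ p₀₃ ∷ p₀₄ ∷ [])
      (a₁₂ , p₁₃ ∷ p₁₄ ∷ p₁₅ ∷ [] , a₂₃ , p₂₄ ∷ p₂₅ ∷ [] , a₃₄ , p₃₅ ∷ [] , a₄₅ , [] , _)

module BreadthFirstLevels {n : ℕ} (G : Graph n) (connected : Connected G) (v₀ : Fin n) where
  open Graph G renaming (sym to adj-sym)
  open Walks G

  private
    ℓ-distance : ∀ v → ∃ (IsDist G v₀ v)
    ℓ-distance v = distance (proj₂ (connected v₀ v))

  ℓ : Fin n → ℕ
  ℓ v = proj₁ (ℓ-distance v)

  ℓ-reach : ∀ v → Reach G (ℓ v) v₀ v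
  ℓ-reach v = proj₁ (proj₂ (ℓ-distance v))

  ℓ-minimal : ∀ {v m} → Reach G m v₀ v → ℓ v ≤ m
  ℓ-minimal {v} = proj₂ (proj₂ (ℓ-distance v)) _

  ℓ-dist : ∀ v → IsDist G v₀ v (ℓ v)
  ℓ-dist v = ℓ-reach v , λ _ → ℓ-minimal

  ℓ-adj : ∀ {x y} → Adj x y → ℓ y ≤ suc (ℓ x)
  ℓ-adj {x} a = ℓ-minimal (reach-snoc (ℓ-reach x) a)

  ℓ-root : ℓ v₀ ≡ 0
  ℓ-root = n≤0⇒n≡0 (ℓ-minimal here)

  ℓ≡0⇒root : ∀ {x} → ℓ x ≡ 0 → x ≡ v₀
  ℓ≡0⇒root {x} e = sym (reach-zero (subst (λ k → Reach G k v₀ x) e (ℓ-reach x)))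

  ℓ≡1⇒adj-root : ∀ {x} → ℓ x ≡ 1 → Adj v₀ x
  ℓ≡1⇒adj-root {x} e with reach-one (subst (λ k → Reach G k v₀ x) e (ℓ-reach x))
  ... | inj₁ refl = contradiction (trans (sym ℓ-root) e) 0≢1+n
  ... | inj₂ a = a

  predecessor : ∀ {x m} → ℓ x ≡ suc m → ∃ λ y → Adj x y × ℓ y ≡ m
  predecessor {x} = go (reach-sym (ℓ-reach x)) refl
    where
    go : ∀ {k z m} → Reach G k z v₀ → k ≡ ℓ z → ℓ z ≡ suc m → ∃ λ y → Adj z y × ℓ y ≡ m
    go here _ ℓz = contradiction (trans (sym ℓ-root) ℓz) 0≢1+n
    go (step {w = y} zy r) k+1≡ℓz ℓz = y , zy , ≤-antisym
      (subst (ℓ y ≤_) (suc-injective (trans k+1≡ℓz ℓz)) (ℓ-minimal (reach-sym r)))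
      (≤-pred (subst (_≤ suc (ℓ y)) ℓz (ℓ-adj (adj-sym zy))))

  ≢-by-level : ∀ {p q a b} → ℓ p ≡ a → ℓ q ≡ b → a ≢ b → p ≢ q
  ≢-by-level ℓp ℓq a≢b refl = a≢b (trans (sym ℓp) ℓq)

  ¬adj-by-level : ∀ {p q a b} → ℓ p ≡ a → ℓ q ≡ b → 2 + a ≤ b → ¬ Adj p q
  ¬adj-by-level ℓp ℓq 2+a≤b pq = 1+n≰n (≤-trans 2+a≤b (subst₂ _≤_ ℓq (cong suc ℓp) (ℓ-adj pq)))

  apart-by-level : ∀ {p q a b} → ℓ p ≡ a → ℓ q ≡ b → 2 + a ≤ b → Apart p q
  apart-by-level ℓp ℓq 2+a≤b = ≢-by-level ℓp ℓq (<⇒≢ (≤-trans (n≤1+n _) 2+a≤b)) , ¬adj-by-level ℓp ℓq 2+a≤b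

  ℓ-adj-bounds : ∀ {p q a b} → ℓ p ≡ a → ℓ q ≡ b → Adj p q → b ≤ suc a × a ≤ suc b
  ℓ-adj-bounds ℓp ℓq pq = subst₂ _≤_ ℓq (cong suc ℓp) (ℓ-adj pq) , subst₂ _≤_ ℓp (cong suc ℓq) (ℓ-adj (adj-sym pq))

  ℓ-geodesic : ∀ {d w} (W : Walk d v₀ w) → ℓ w ≡ d → ∀ s → s ≤ d → ℓ (vtx W s) ≡ s
  ℓ-geodesic {d} {w} W ℓw s s≤d = ≤-antisym ℓ≤s s≤ℓ
    where
    ℓ≤s : ℓ (vtx W s) ≤ s
    ℓ≤s = ℓ-minimal (subst (λ z → Reach G s z (vtx W s)) (vtx-0 W) (walk-segment W s 0 s≤d))
    rest : Reach G (d ∸ s) (vtx W s) w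
    rest = subst (Reach G (d ∸ s) (vtx W s)) (trans (cong (vtx W) (m+[n∸m]≡n s≤d)) (vtx-len W))
             (walk-segment W (d ∸ s) s (≤-reflexive (m+[n∸m]≡n s≤d)))
    s≤ℓ : s ≤ ℓ (vtx W s)
    s≤ℓ = +-cancelʳ-≤ (d ∸ s) s (ℓ (vtx W s))
            (subst (_≤ ℓ (vtx W s) + (d ∸ s)) (trans ℓw (sym (m+[n∸m]≡n s≤d)))
              (ℓ-minimal (reach-trans (ℓ-reach (vtx W s)) rest)))

module LabelingInvariant {n : ℕ} (G : Graph n) (connected : Connected G) (v₀ : Fin n) where
  open Graph G renaming (sym to adj-sym)
  open Walks G
  open BreadthFirstLevels G connected v₀

  MinimalPick : List (Fin n) → Fin n → Fin n → Set
  MinimalPick J u v = ∀ w → Adj u w → w ∉ J → outdeg G J v ≤ outdeg G J w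

  -- An earliest labelled neighbour of the vertex v at position i; v is labelled while this parent is processed.
  record Parent (L : List (Fin n)) (i : ℕ) (v : Fin n) : Set where
    field
      pos      : ℕ
      vertex   : Fin n
      pos<i    : pos < i
      at-pos   : At L pos vertex
      adj      : Adj vertex v
      earliest : ∀ {q w} → q < pos → At L q w → ¬ Adj w v
  open Parent

  parent-pos-unique : ∀ {L i i′ v} (P : Parent L i v) (P′ : Parent L i′ v) → pos P ≡ pos P′
  parent-pos-unique P P′ with <-cmp (pos P) (pos P′)
  ... | tri< p<p′ _ _ = contradiction (adj P) (earliest P′ p<p′ (at-pos P))
  ... | tri≈ _ e _ = e
  ... | tri> _ _ p′<p = contradiction (adj P′) (earliest P p′<p (at-pos P′))

  parent-++⁺ : ∀ {L ys i v} → Parent L i v → i < length L → Parent (L ++ ys) i v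
  parent-++⁺ P i<l = record
    { pos = pos P ; vertex = vertex P ; pos<i = pos<i P ; adj = adj P
    ; at-pos = At-++⁺ˡ (at-pos P)
    ; earliest = λ q<p aq → earliest P q<p (At-++⁻ˡ aq (<-trans q<p (<-trans (pos<i P) i<l))) }

  parent-++⁻ : ∀ {L ys i v} → Parent (L ++ ys) i v → i < length L → Parent L i v
  parent-++⁻ P i<l = record
    { pos = pos P ; vertex = vertex P ; pos<i = pos<i P ; adj = adj P
    ; at-pos = At-++⁻ˡ (at-pos P) (<-trans (pos<i P) i<l)
    ; earliest = λ q<p aq → earliest P q<p (At-++⁺ˡ aq) }

  -- The vertex v at position i of L was picked, as a neighbour of minimal |N(v)∖J| with J the first i
  -- labelled vertices, while processing its parent, at some step at most j.
  PickedBy : ℕ → List (Fin n) → ℕ → Fin n → Set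
  PickedBy j L i v = Σ (Parent L i v) λ P → pos P ≤ j × suc (ℓ (vertex P)) ≡ ℓ v × MinimalPick (take i L) (vertex P) v

  record Invariant (j : ℕ) (L : List (Fin n)) : Set where
    field
      processed≤length : j ≤ length L
      position-unique  : ∀ {i i′ x} → At L i x → At L i′ x → i ≡ i′
      processed-closed : ∀ {q u w} → q < j → At L q u → Adj u w → w ∈ L
      level-monotone   : ∀ {i i′ x y} → i ≤ i′ → At L i x → At L i′ y → ℓ x ≤ ℓ y
      level-bounded    : ∀ {u i y} → At L j u → At L i y → ℓ y ≤ suc (ℓ u)
      lower-labelled   : ∀ {u x} → At L j u → ℓ x ≤ ℓ u → x ∈ L
      parent           : ∀ {i v} → At L i v → 0 < i → PickedBy j L i v
      parent-monotone  : ∀ {i i′ v v′} → i < i′ → At L i v → At L i′ v′ →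
                         (P : Parent L i v) (P′ : Parent L i′ v′) → pos P ≤ pos P′

  invariant-start : Invariant 0 [ v₀ ]
  invariant-start = record
    { processed≤length = z≤n
    ; position-unique = λ { at-here at-here → refl }
    ; processed-closed = λ ()
    ; level-monotone = λ { _ at-here at-here → ≤-refl }
    ; level-bounded = λ { at-here at-here → n≤1+n _ }
    ; lower-labelled = λ { {x = x} at-here ℓx≤ℓv₀ → here (ℓ≡0⇒root (n≤0⇒n≡0 (subst (ℓ x ≤_) ℓ-root ℓx≤ℓv₀))) }
    ; parent = λ { at-here () }
    ; parent-monotone = λ { _ at-here _ P _ → contradiction (pos<i P) λ () } }

  module PickStep {j L u v} (I : Invariant j L) (at-u : At L j u) (uv : Adj u v) (v∉L : v ∉ L)
                  (minimal : MinimalPick L u v) where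
    open Invariant I

    L′ : List (Fin n)
    L′ = L ++ [ v ]

    j<length : j < length L
    j<length = At⇒<length at-u

    v-unlabelled : ∀ {i} → ¬ At L i v
    v-unlabelled = v∉L ∘ At⇒∈

    ℓ-picked : ℓ v ≡ suc (ℓ u)
    ℓ-picked with ℓ v ≤? ℓ u
    ... | yes ℓv≤ℓu = contradiction (lower-labelled at-u ℓv≤ℓu) v∉L
    ... | no ℓv≰ℓu = ≤-antisym (ℓ-adj uv) (≰⇒> ℓv≰ℓu)

    ∈-++⁺ : ∀ {x} → x ∈ L → x ∈ L′
    ∈-++⁺ = At⇒∈ ∘ At-++⁺ˡ ∘ proj₂ ∘ ∈⇒At

    new-parent : Parent L′ (length L) v
    new-parent = record
      { pos = j ; vertex = u ; pos<i = j<length ; at-pos = At-++⁺ˡ at-u ; adj = uv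
      ; earliest = earliest′ }
      where
      earliest′ : ∀ {q w} → q < j → At L′ q w → ¬ Adj w v
      earliest′ q<j aq wv with At-snoc⁻ L aq
      ... | inj₁ aq′ = v∉L (processed-closed q<j aq′ wv)
      ... | inj₂ (refl , _) = <-asym q<j j<length

    position-unique′ : ∀ {i i′ x} → At L′ i x → At L′ i′ x → i ≡ i′
    position-unique′ ai ai′ with At-snoc⁻ L ai | At-snoc⁻ L ai′
    ... | inj₁ ai₀ | inj₁ ai′₀ = position-unique ai₀ ai′₀
    ... | inj₁ ai₀ | inj₂ (_ , refl) = contradiction ai₀ v-unlabelled
    ... | inj₂ (_ , refl) | inj₁ ai′₀ = contradiction ai′₀ v-unlabelled
    ... | inj₂ (refl , _) | inj₂ (refl , _) = refl

    processed-closed′ : ∀ {q x w} → q < j → At L′ q x → Adj x w → w ∈ L′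
    processed-closed′ q<j aq xw = ∈-++⁺ (processed-closed q<j (At-++⁻ˡ aq (<-trans q<j j<length)) xw)

    level-monotone′ : ∀ {i i′ x y} → i ≤ i′ → At L′ i x → At L′ i′ y → ℓ x ≤ ℓ y
    level-monotone′ i≤i′ ai ai′ with At-snoc⁻ L ai | At-snoc⁻ L ai′
    ... | inj₁ ai₀ | inj₁ ai′₀ = level-monotone i≤i′ ai₀ ai′₀
    ... | inj₁ ai₀ | inj₂ (_ , refl) = ≤-trans (level-bounded at-u ai₀) (≤-reflexive (sym ℓ-picked))
    ... | inj₂ (refl , _) | inj₁ ai′₀ = contradiction (≤-trans (s≤s i≤i′) (At⇒<length ai′₀)) (<-irrefl refl)
    ... | inj₂ (_ , refl) | inj₂ (_ , refl) = ≤-refl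

    level-bounded′ : ∀ {u′ i y} → At L′ j u′ → At L′ i y → ℓ y ≤ suc (ℓ u′)
    level-bounded′ au′ ai with At-functional au′ (At-++⁺ˡ at-u) | At-snoc⁻ L ai
    ... | refl | inj₁ ai₀ = level-bounded at-u ai₀
    ... | refl | inj₂ (_ , refl) = ≤-reflexive ℓ-picked

    lower-labelled′ : ∀ {u′ x} → At L′ j u′ → ℓ x ≤ ℓ u′ → x ∈ L′
    lower-labelled′ au′ ℓx≤ with At-functional au′ (At-++⁺ˡ at-u)
    ... | refl = ∈-++⁺ (lower-labelled at-u ℓx≤)

    parent′ : ∀ {i x} → At L′ i x → 0 < i → PickedBy j L′ i x
    parent′ ai 0<i with At-snoc⁻ L ai
    ... | inj₂ (refl , refl) =
          new-parent , ≤-refl , sym ℓ-picked , subst (λ J → MinimalPick J u v) (sym (take-length-++ L [ v ])) minimal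
    ... | inj₁ ai₀ with parent ai₀ 0<i
    ...   | P , p≤j , ℓP , minimal₀ =
            parent-++⁺ P (At⇒<length ai₀) , p≤j , ℓP ,
            subst (λ J → MinimalPick J (vertex P) _) (sym (take-++ L [ v ] _ (<⇒≤ (At⇒<length ai₀)))) minimal₀

    parent-monotone′ : ∀ {i i′ x x′} → i < i′ → At L′ i x → At L′ i′ x′ →
                       (P : Parent L′ i x) (P′ : Parent L′ i′ x′) → pos P ≤ pos P′
    parent-monotone′ {i} i<i′ ai ai′ P P′ with At-snoc⁻ L ai′
    ... | inj₁ ai′₀ = parent-monotone i<i′ (At-++⁻ˡ ai i<length) ai′₀
                        (parent-++⁻ P i<length) (parent-++⁻ P′ (At⇒<length ai′₀))
      where
      i<length : i < length L
      i<length = <-trans i<i′ (At⇒<length ai′₀)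
    ... | inj₂ (refl , refl) with parent (At-++⁻ˡ ai i<i′) (≤-trans (s≤s z≤n) (pos<i P))
    ...   | P₀ , p₀≤j , _ =
            subst₂ _≤_ (parent-pos-unique P₀ (parent-++⁻ P i<i′)) (parent-pos-unique new-parent P′) p₀≤j

    invariant : Invariant j L′
    invariant = record
      { processed≤length = ≤-trans processed≤length (subst (length L ≤_) (sym (length-++ L)) (m≤m+n _ _))
      ; position-unique = position-unique′
      ; processed-closed = processed-closed′
      ; level-monotone = level-monotone′
      ; level-bounded = level-bounded′
      ; lower-labelled = lower-labelled′
      ; parent = parent′
      ; parent-monotone = parent-monotone′ }

  module NextStep {j L u} (I : Invariant j L) (at-u : At L j u) (saturated : ∀ w → Adj u w → w ∈ L) where
    open Invariant I

    processed-closed′ : ∀ {q x w} → q < suc j → At L q x → Adj x w → w ∈ L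
    processed-closed′ {q} q≤j aq xw with m≤n⇒m<n∨m≡n (≤-pred q≤j)
    ... | inj₁ q<j = processed-closed q<j aq xw
    ... | inj₂ refl with At-functional aq at-u
    ...   | refl = saturated _ xw

    lower-labelled′ : ∀ {u′ x} → At L (suc j) u′ → ℓ x ≤ ℓ u′ → x ∈ L
    lower-labelled′ {u′} {x} au′ ℓx≤ℓu′ with ℓ x ≤? ℓ u
    ... | yes ℓx≤ℓu = lower-labelled at-u ℓx≤ℓu
    ... | no ℓx≰ℓu = via-predecessor (predecessor ℓx)
      where
      ℓx : ℓ x ≡ suc (ℓ u)
      ℓx = ≤-antisym (≤-trans ℓx≤ℓu′ (level-bounded at-u au′)) (≰⇒> ℓx≰ℓu)
      via-predecessor : (∃ λ y → Adj x y × ℓ y ≡ ℓ u) → x ∈ L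
      via-predecessor (y , xy , ℓy≡ℓu) with ∈⇒At (lower-labelled at-u (≤-reflexive ℓy≡ℓu))
      ... | q , aq with q <? suc j
      ...   | yes q≤j = processed-closed′ q≤j aq (adj-sym xy)
      ...   | no q≰j = contradiction ℓx≤ℓu′ (<⇒≱ (begin-strict
                ℓ u′  ≤⟨ level-monotone (≮⇒≥ q≰j) au′ aq ⟩
                ℓ y   <⟨ ≤-reflexive (sym (trans ℓx (cong suc (sym ℓy≡ℓu)))) ⟩
                ℓ x   ∎))
        where open ≤-Reasoning

    invariant : Invariant (suc j) L
    invariant = record
      { processed≤length = At⇒<length at-u
      ; position-unique = position-unique
      ; processed-closed = processed-closed′
      ; level-monotone = level-monotone
      ; level-bounded = λ au′ ai → ≤-trans (level-bounded at-u ai) (s≤s (level-monotone (n≤1+n j) at-u au′))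
      ; lower-labelled = lower-labelled′
      ; parent = λ ai 0<i → let P , p≤j , rest = parent ai 0<i in P , m≤n⇒m≤1+n p≤j , rest
      ; parent-monotone = parent-monotone }

  invariant : ∀ {j L} → AlgState G j L → At L 0 v₀ → Invariant j L
  invariant (start _ _ _) at-here = invariant-start
  invariant (pick s at-u uv v∉L minimal) at-0 =
    PickStep.invariant (invariant s (At-++⁻ˡ at-0 (≤-trans (s≤s z≤n) (At⇒<length at-u)))) at-u uv v∉L minimal
  invariant (next s at-u saturated) at-0 = NextStep.invariant (invariant s at-0) at-u saturated

  module _ {L} (I : Invariant n L) (at-0 : At L 0 v₀) where
    open Invariant I

    length≤n : length L ≤ n
    length≤n with length L ≤? n
    ... | yes l≤n = l≤n
    ... | no l≰n with pigeonhole (≰⇒> l≰n) (lookup L)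
    ...   | i , k , i<k , e = contradiction
              (position-unique (At-lookup L i) (subst (At L (toℕ k)) (sym e) (At-lookup L k))) (<⇒≢ i<k)

    all-labelled : ∀ x → x ∈ L
    all-labelled x = labelled-along (At⇒∈ at-0) (proj₂ (connected v₀ x))
      where
      length≡n : length L ≡ n
      length≡n = ≤-antisym length≤n processed≤length
      labelled-along : ∀ {k y x} → y ∈ L → Reach G k y x → x ∈ L
      labelled-along y∈L here = y∈L
      labelled-along y∈L (step yw r) with ∈⇒At y∈L
      ... | q , aq = labelled-along (processed-closed (subst (q <_) length≡n (At⇒<length aq)) aq yw) r


module LevelCliques {n : ℕ} (G : Graph n) (connected : Connected G) (chordal : Chordal G)
                    (claw-free : ClawFree G) (narrow : Narrow G) {v₀ : Fin n} (D : Walks.DiametralWalk G v₀)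
                    (min-degree : ∀ w → IsLSPEndpoint G w → deg G v₀ ≤ deg G w) where
  open Graph G renaming (sym to adj-sym)
  open Walks G
  open BreadthFirstLevels G connected v₀
  open InducedCycles G chordal
  open DiametralWalk D renaming (diam to d; far to w₀; walk to Q; dist to dist-w₀)

  ℓ-w₀ : ℓ w₀ ≡ d
  ℓ-w₀ = dist-unique (ℓ-dist w₀) dist-w₀

  ℓ≤d : ∀ x → ℓ x ≤ d
  ℓ≤d x = ℓ-minimal (proj₂ is-diam v₀ x)

  near-geodesic : ∀ {w} (W : Walk d v₀ w) → ℓ w ≡ d → ∀ x → ∃ λ s → s ≤ d × (vtx W s ≡ x ⊎ Adj x (vtx W s))
  near-geodesic {w} W ℓw = narrow-diametral record
    { walk = W ; dist = subst (IsDist G v₀ w) ℓw (ℓ-dist w) ; is-diam = is-diam } narrow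

  not-apart-from-geodesic : ∀ {w x} (W : Walk d v₀ w) → ℓ w ≡ d → ¬ (∀ s → s ≤ d → Apart x (vtx W s))
  not-apart-from-geodesic {x = x} W ℓw apart with near-geodesic W ℓw x
  ... | s , s≤d , hit = [ proj₁ (apart s s≤d) ∘ sym , proj₂ (apart s s≤d) ]′ hit

  -- Preceded by a shortest walk from v₀ to v, this is a walk of length d from v₀ to w (geodesic-through).
  GeodesicTail : Fin n → Fin n → Set
  GeodesicTail w v = Walk (d ∸ ℓ v) v w

  shortest-walk : ∀ v → Walk (ℓ v) v₀ v
  shortest-walk v with reach⇒walk (ℓ-reach v)
  ... | m , m≤ℓv , W = walk-cast (≤-antisym m≤ℓv (ℓ-minimal (walk⇒reach W))) W

  geodesic-through : ∀ {w v} → GeodesicTail w v → Walk d v₀ w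
  geodesic-through {v = v} T = walk-cast (m+[n∸m]≡n (ℓ≤d v)) (walk-++ (shortest-walk v) T)

  geodesic-through-at : ∀ {w v} (T : GeodesicTail w v) → vtx (geodesic-through T) (ℓ v) ≡ v
  geodesic-through-at {v = v} T = trans (walk-++-prefix (shortest-walk v) T ≤-refl) (vtx-len (shortest-walk v))

  tail-step : ∀ {w a h} → Adj a h → ℓ h ≡ suc (ℓ a) → GeodesicTail w h → GeodesicTail w a
  tail-step {a = a} {h} ah ℓh T =
    walk-cast (trans (cong (λ z → suc (d ∸ z)) ℓh) (sym (+-∸-assoc 1 (subst (_≤ d) ℓh (ℓ≤d h))))) (walk-∷ ah T)

  ℓ-Q : ∀ s → s ≤ d → ℓ (vtx Q s) ≡ s
  ℓ-Q = ℓ-geodesic Q ℓ-w₀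

  Q-tail : ∀ t → t ≤ d → GeodesicTail w₀ (vtx Q t)
  Q-tail t t≤d = walk-cast (cong (d ∸_) (sym (ℓ-Q t t≤d))) (walk-drop Q t t≤d)

  Clique : ℕ → Set
  Clique t = ∀ x y → ℓ x ≡ t → ℓ y ≡ t → x ≡ y ⊎ Adj x y

  -- Otherwise z, its predecessor, b and g form a claw.
  lower-neighbour⇒adjacent : ∀ {k z b g} → ℓ z ≡ suc k → Adj z b → Adj z g → ℓ b ≡ 2 + k → ℓ g ≡ 2 + k →
                             b ≡ g ⊎ Adj b g
  lower-neighbour⇒adjacent {z = z} {b} {g} ℓz zb zg ℓb ℓg = equal-or-adjacent λ (b≢g , ¬bg) →
    let y , zy , ℓy = predecessor ℓz
        yb = apart-by-level ℓy ℓb ≤-refl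
        yg = apart-by-level ℓy ℓg ≤-refl
    in [ proj₂ yb , [ proj₂ yg , ¬bg ]′ ]′ (claw-free z y b g zy zb zg (proj₁ yb) (proj₁ yg) b≢g)

  -- Otherwise the predecessors of b and g, adjacent as level k+1 is a clique, close an induced 5-cycle through h.
  upper-neighbour⇒adjacent : ∀ {k b g h} → Clique (suc k) → ℓ b ≡ 2 + k → ℓ g ≡ 2 + k → ℓ h ≡ 3 + k →
                             Adj b h → Adj g h → b ≡ g ⊎ Adj b g
  upper-neighbour⇒adjacent {k} {b} {g} {h} clique ℓb ℓg ℓh bh gh =
    equal-or-adjacent λ b-g → no-cycle b-g (predecessor ℓg) (predecessor ℓb)
    where
    no-cycle : Apart b g → (∃ λ pg → Adj g pg × ℓ pg ≡ suc k) → (∃ λ pb → Adj b pb × ℓ pb ≡ suc k) → ⊥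
    no-cycle (b≢g , ¬bg) (pg , g-pg , ℓpg) (pb , b-pb , ℓpb) with adj? pg b | adj? pb g
    ... | yes pg-b | _ = [ b≢g , ¬bg ]′ (lower-neighbour⇒adjacent ℓpg pg-b (adj-sym g-pg) ℓb ℓg)
    ... | no _ | yes pb-g = [ b≢g , ¬bg ]′ (lower-neighbour⇒adjacent ℓpb (adj-sym b-pb) pb-g ℓb ℓg)
    ... | no ¬pg-b | no ¬pb-g with clique pg pb ℓpg ℓpb
    ...   | inj₁ refl = ¬pg-b (adj-sym b-pb)
    ...   | inj₂ pg-pb = C5-free g-pg pg-pb (adj-sym b-pb) bh (adj-sym gh)
              (≢-by-level ℓg ℓpb 1+n≢n , ¬pb-g ∘ adj-sym) (b≢g ∘ sym , ¬bg ∘ adj-sym)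
              (≢-by-level ℓpg ℓb (1+n≢n ∘ sym) , ¬pg-b) (apart-by-level ℓpg ℓh ≤-refl) (apart-by-level ℓpb ℓh ≤-refl)

  -- By narrowness b is on or next to the geodesic through g; levels then leave three cases.
  on-geodesic⇒adjacent : ∀ {k w g b} → Clique (suc k) → ℓ w ≡ d → GeodesicTail w g → ℓ g ≡ 2 + k → ℓ b ≡ 2 + k →
                         b ≡ g ⊎ Adj b g
  on-geodesic⇒adjacent {k} {w} {g} {b} clique ℓw T ℓg ℓb = near (near-geodesic P ℓw b)
    where
    P : Walk d v₀ w
    P = geodesic-through T
    t : ℕ
    t = 2 + k
    P-t : vtx P t ≡ g
    P-t = subst (λ i → vtx P i ≡ g) ℓg (geodesic-through-at T)
    t≤d : t ≤ d
    t≤d = subst (_≤ d) ℓg (ℓ≤d g)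
    ℓ-P : ∀ s → s ≤ d → ℓ (vtx P s) ≡ s
    ℓ-P = ℓ-geodesic P ℓw
    near : (∃ λ s → s ≤ d × (vtx P s ≡ b ⊎ Adj b (vtx P s))) → b ≡ g ⊎ Adj b g
    near (s , s≤d , inj₁ P-s) = inj₁ (trans (sym P-s) (trans (cong (vtx P) s≡t) P-t))
      where
      s≡t : s ≡ t
      s≡t = trans (sym (ℓ-P s s≤d)) (trans (cong ℓ P-s) ℓb)
    near (s , s≤d , inj₂ b-Ps) with ℓ-adj-bounds ℓb (ℓ-P s s≤d) b-Ps | <-cmp s t
    ... | _ | tri≈ _ s≡t _ = inj₂ (subst (Adj b) (trans (cong (vtx P) s≡t) P-t) b-Ps)
    ... | (_ , t≤s+1) | tri< s<t _ _ = lower-neighbour⇒adjacent (trans (ℓ-P s s≤d) s≡k+1) (adj-sym b-Ps) Ps-g ℓb ℓg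
      where
      s≡k+1 : s ≡ suc k
      s≡k+1 = ≤-antisym (≤-pred s<t) (≤-pred t≤s+1)
      Ps-g : Adj (vtx P s) g
      Ps-g = subst (Adj (vtx P s)) (trans (cong (vtx P ∘ suc) s≡k+1) P-t) (edge P s (≤-trans s<t t≤d))
    ... | (s≤t+1 , _) | tri> _ _ t<s = upper-neighbour⇒adjacent clique ℓb ℓg (trans (ℓ-P s s≤d) s≡t+1) b-Ps g-Ps
      where
      s≡t+1 : s ≡ suc t
      s≡t+1 = ≤-antisym s≤t+1 t<s
      g-Ps : Adj g (vtx P s)
      g-Ps = subst₂ Adj P-t (cong (vtx P) (sym s≡t+1)) (edge P t (≤-trans t<s s≤d))

  -- Apart p and q lie on no geodesic of length d (on-geodesic⇒adjacent). Yet p does if ℓ p = d, and otherwise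
  -- both are adjacent to the vertex of Q on their level, so the claw there puts p or q next to Q's next vertex.
  clique-step : ∀ k → Clique (suc k) → Clique (2 + k)
  clique-step k clique p q ℓp ℓq = equal-or-adjacent λ p-q → apart-at-level p-q ℓp ℓq
    where
    t : ℕ
    t = 2 + k
    no-tail : ∀ {w p q} → Apart p q → ℓ p ≡ t → ℓ q ≡ t → ℓ w ≡ d → GeodesicTail w p → ⊥
    no-tail (p≢q , ¬pq) ℓp ℓq ℓw T = [ p≢q ∘ sym , ¬pq ∘ adj-sym ]′ (on-geodesic⇒adjacent clique ℓw T ℓp ℓq)
    apart-at-level : ∀ {p q} → Apart p q → ℓ p ≡ t → ℓ q ≡ t → ⊥
    apart-at-level {p} {q} p-q ℓp ℓq with m≤n⇒m<n∨m≡n (subst (_≤ d) ℓp (ℓ≤d p))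
    ... | inj₂ t≡d = no-tail p-q ℓp ℓq (trans ℓp t≡d)
                       (walk-cast (sym (trans (cong (d ∸_) (trans ℓp t≡d)) (n∸n≡0 d))) (walk-[] p))
    ... | inj₁ t<d with on-geodesic⇒adjacent clique ℓ-w₀ (Q-tail t (<⇒≤ t<d)) (ℓ-Q t (<⇒≤ t<d)) ℓp
                      | on-geodesic⇒adjacent clique ℓ-w₀ (Q-tail t (<⇒≤ t<d)) (ℓ-Q t (<⇒≤ t<d)) ℓq
    ...   | inj₁ p≡Qt | _ = no-tail p-q ℓp ℓq ℓ-w₀ (subst (GeodesicTail w₀) (sym p≡Qt) (Q-tail t (<⇒≤ t<d)))
    ...   | inj₂ _ | inj₁ q≡Qt =
            no-tail (apart-sym p-q) ℓq ℓp ℓ-w₀ (subst (GeodesicTail w₀) (sym q≡Qt) (Q-tail t (<⇒≤ t<d)))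
    ...   | inj₂ p-Qt | inj₂ q-Qt =
            [ proj₂ p-q , [ (λ p-Qt+1 → no-tail p-q ℓp ℓq ℓ-w₀ (step-back p-Qt+1 ℓp))
                          , (λ q-Qt+1 → no-tail (apart-sym p-q) ℓq ℓp ℓ-w₀ (step-back q-Qt+1 ℓq)) ]′ ]′
              (claw-free (vtx Q t) p q (vtx Q (suc t)) (adj-sym p-Qt) (adj-sym q-Qt) (edge Q t t<d) (proj₁ p-q)
                 (≢-by-level ℓp (ℓ-Q (suc t) t<d) (<⇒≢ (n<1+n t))) (≢-by-level ℓq (ℓ-Q (suc t) t<d) (<⇒≢ (n<1+n t))))
      where
      step-back : ∀ {x} → Adj x (vtx Q (suc t)) → ℓ x ≡ t → GeodesicTail w₀ x
      step-back x-Qt+1 ℓx = tail-step x-Qt+1 (trans (ℓ-Q (suc t) t<d) (cong suc (sym ℓx))) (Q-tail (suc t) t<d)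

  child-¬adj-sibling : ∀ {x y c} → ℓ x ≡ 1 → ℓ y ≡ 1 → Apart x y → Adj x c → ℓ c ≡ 2 → ¬ Adj c y
  child-¬adj-sibling ℓx ℓy x-y xc ℓc cy =
    C4-free (ℓ≡1⇒adj-root ℓx) xc cy (adj-sym (ℓ≡1⇒adj-root ℓy)) (apart-by-level ℓ-root ℓc ≤-refl) x-y

  children-apart : ∀ {x y c e} → ℓ x ≡ 1 → ℓ y ≡ 1 → Apart x y → Adj x c → ℓ c ≡ 2 → Adj y e → ℓ e ≡ 2 → Apart c e
  children-apart {c = c} {e} ℓx ℓy x-y xc ℓc ye ℓe = c≢e , ¬ce
    where
    c≢e : c ≢ e
    c≢e refl = child-¬adj-sibling ℓx ℓy x-y xc ℓc (adj-sym ye)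
    ¬ce : ¬ Adj c e
    ¬ce ce = C5-free (ℓ≡1⇒adj-root ℓx) xc ce (adj-sym ye) (adj-sym (ℓ≡1⇒adj-root ℓy))
      (apart-by-level ℓ-root ℓc ≤-refl) (apart-by-level ℓ-root ℓe ≤-refl)
      (≢-by-level ℓx ℓe (λ ()) , child-¬adj-sibling ℓy ℓx (apart-sym x-y) ye ℓe ∘ adj-sym)
      x-y (≢-by-level ℓc ℓy (λ ()) , child-¬adj-sibling ℓx ℓy x-y xc ℓc)

  -- e would have to be on or next to the geodesic v₀ x c …, closing an induced cycle of length 4, 5 or 6.
  no-geodesic-through-child : ∀ {x y c e w} → ℓ x ≡ 1 → ℓ y ≡ 1 → Apart x y → Adj x c → ℓ c ≡ 2 → Adj y e → ℓ e ≡ 2 →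
                              2 ≤ d → ℓ w ≡ d → Walk (d ∸ 2) c w → ⊥
  no-geodesic-through-child {c = c} {e} ℓx ℓy x-y xc ℓc ye ℓe 2≤d ℓw W = not-apart-from-geodesic R ℓw e-apart
    where
    R : Walk d v₀ _
    R = walk-cast (m+[n∸m]≡n 2≤d) (walk-∷ (ℓ≡1⇒adj-root ℓx) (walk-∷ xc W))
    ℓ-R : ∀ s → s ≤ d → ℓ (vtx R s) ≡ s
    ℓ-R = ℓ-geodesic R ℓw
    c-e : Apart c e
    c-e = children-apart ℓx ℓy x-y xc ℓc ye ℓe
    e-apart : ∀ s → s ≤ d → Apart e (vtx R s)
    e-apart 0 _ = apart-sym (apart-by-level ℓ-root ℓe ≤-refl)
    e-apart 1 _ = ≢-by-level ℓe ℓx (λ ()) , child-¬adj-sibling ℓy ℓx (apart-sym x-y) ye ℓe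
    e-apart 2 _ = subst (Apart e) (sym (vtx-0 W)) (apart-sym c-e)
    e-apart 3 s≤d = ≢-by-level ℓe (ℓ-R 3 s≤d) (λ ()) , λ eh →
      C6-free (ℓ≡1⇒adj-root ℓx) xc (subst (λ z → Adj z (vtx W 1)) (vtx-0 W) (edge W 0 (∸-monoˡ-≤ 2 s≤d)))
        (adj-sym eh) (adj-sym ye) (adj-sym (ℓ≡1⇒adj-root ℓy))
        (apart-by-level ℓ-root ℓc ≤-refl) (apart-by-level ℓ-root (ℓ-R 3 s≤d) (s≤s (s≤s z≤n)))
        (apart-by-level ℓ-root ℓe ≤-refl)
        (apart-by-level ℓx (ℓ-R 3 s≤d) ≤-refl)
        (≢-by-level ℓx ℓe (λ ()) , child-¬adj-sibling ℓy ℓx (apart-sym x-y) ye ℓe ∘ adj-sym) x-y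
        c-e (≢-by-level ℓc ℓy (λ ()) , child-¬adj-sibling ℓx ℓy x-y xc ℓc)
        (apart-sym (apart-by-level ℓy (ℓ-R 3 s≤d) ≤-refl))
    e-apart (suc (suc (suc (suc s)))) s≤d = apart-by-level ℓe (ℓ-R _ s≤d) (s≤s (s≤s (s≤s (s≤s z≤n))))

  diameter≥2 : ∀ {x y} → Apart x y → 2 ≤ d
  diameter≥2 {x} {y} (x≢y , ¬xy) with 2 ≤? d
  ... | yes 2≤d = 2≤d
  ... | no 2≰d = ⊥-elim ([ x≢y , ¬xy ]′ (reach-one (reach-weaken (≤-pred (≰⇒> 2≰d)) (proj₂ is-diam x y))))

  module _ (2≤d : 2 ≤ d) where
    private
      1≤d : 1 ≤ d
      1≤d = ≤-trans (n≤1+n 1) 2≤d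
      q₁ q₂ : Fin n
      q₁ = vtx Q 1
      q₂ = vtx Q 2
      ℓq₁ : ℓ q₁ ≡ 1
      ℓq₁ = ℓ-Q 1 1≤d
      ℓq₂ : ℓ q₂ ≡ 2
      ℓq₂ = ℓ-Q 2 2≤d
      v₀-q₁ : Adj v₀ q₁
      v₀-q₁ = subst (λ z → Adj z q₁) (vtx-0 Q) (edge Q 0 1≤d)
      q₁-q₂ : Adj q₁ q₂
      q₁-q₂ = edge Q 1 2≤d
      q₂-tail : Walk (d ∸ 2) q₂ w₀
      q₂-tail = walk-drop Q 2 2≤d

      no-tail : ∀ {x y c e} → ℓ x ≡ 1 → ℓ y ≡ 1 → Apart x y → Adj x c → ℓ c ≡ 2 → Adj y e → ℓ e ≡ 2 →
                ¬ Walk (d ∸ 2) c w₀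
      no-tail ℓx ℓy x-y xc ℓc ye ℓe = no-geodesic-through-child ℓx ℓy x-y xc ℓc ye ℓe 2≤d ℓ-w₀

      -- Otherwise e is neither on nor next to Q, against narrowness.
      via-q₁ : ∀ {x y c e} → ℓ x ≡ 1 → ℓ y ≡ 1 → Apart x y → Adj x c → ℓ c ≡ 2 → Adj y e → ℓ e ≡ 2 →
               Adj x q₁ → q₁ ≢ y → ⊥
      via-q₁ {x} {y} {c} {e} ℓx ℓy x-y xc ℓc ye ℓe x-q₁ q₁≢y with adj? x q₂ | adj? y q₂ | adj? q₁ y
      ... | yes x-q₂ | _ | _ = no-tail ℓx ℓy x-y x-q₂ ℓq₂ ye ℓe q₂-tail
      ... | no _ | yes y-q₂ | _ = no-tail ℓy ℓx (apart-sym x-y) y-q₂ ℓq₂ xc ℓc q₂-tail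
      ... | no ¬x-q₂ | no ¬y-q₂ | yes q₁-y =
            [ ¬x-q₂ ∘ adj-sym , [ ¬y-q₂ ∘ adj-sym , proj₂ x-y ]′ ]′
              (claw-free q₁ q₂ x y q₁-q₂ (adj-sym x-q₁) q₁-y
                 (≢-by-level ℓq₂ ℓx λ ()) (≢-by-level ℓq₂ ℓy λ ()) (proj₁ x-y))
      ... | no ¬x-q₂ | no ¬y-q₂ | no ¬q₁-y = not-apart-from-geodesic Q ℓ-w₀ e-apart
        where
        ¬q₁-e : ¬ Adj q₁ e
        ¬q₁-e q₁-e = C4-free v₀-q₁ q₁-e (adj-sym ye) (adj-sym (ℓ≡1⇒adj-root ℓy))
                       (apart-by-level ℓ-root ℓe ≤-refl) (q₁≢y , ¬q₁-y)
        e-apart : ∀ s → s ≤ d → Apart e (vtx Q s)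
        e-apart 0 _ = apart-sym (apart-by-level (ℓ-Q 0 z≤n) ℓe ≤-refl)
        e-apart 1 _ = ≢-by-level ℓe ℓq₁ (λ ()) , ¬q₁-e ∘ adj-sym
        e-apart 2 _ = e≢q₂ , ¬e-q₂
          where
          e≢q₂ : e ≢ q₂
          e≢q₂ refl = no-tail ℓy ℓx (apart-sym x-y) ye ℓe xc ℓc q₂-tail
          ¬e-q₂ : ¬ Adj e q₂
          ¬e-q₂ e-q₂ = C5-free v₀-q₁ q₁-q₂ (adj-sym e-q₂) (adj-sym ye) (adj-sym (ℓ≡1⇒adj-root ℓy))
            (apart-by-level ℓ-root ℓq₂ ≤-refl) (apart-by-level ℓ-root ℓe ≤-refl)
            (≢-by-level ℓq₁ ℓe (λ ()) , ¬q₁-e) (q₁≢y , ¬q₁-y) (≢-by-level ℓq₂ ℓy (λ ()) , ¬y-q₂ ∘ adj-sym)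
        e-apart 3 s≤d = ≢-by-level ℓe (ℓ-Q 3 s≤d) (λ ()) , λ e-q₃ →
          no-tail ℓy ℓx (apart-sym x-y) ye ℓe xc ℓc
            (walk-cast (cong (d ∸_) ℓe) (tail-step e-q₃ (trans (ℓ-Q 3 s≤d) (cong suc (sym ℓe))) (Q-tail 3 s≤d)))
        e-apart (suc (suc (suc (suc s)))) s≤d = apart-by-level ℓe (ℓ-Q _ s≤d) (s≤s (s≤s (s≤s (s≤s z≤n))))

    ¬apart-with-children : ∀ {x y c e} → ℓ x ≡ 1 → ℓ y ≡ 1 → Apart x y → Adj x c → ℓ c ≡ 2 → Adj y e → ℓ e ≡ 2 → ⊥
    ¬apart-with-children {x} {y} ℓx ℓy x-y xc ℓc ye ℓe with q₁ ≟ᶠ x | q₁ ≟ᶠ y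
    ... | yes refl | _ = no-tail ℓx ℓy x-y q₁-q₂ ℓq₂ ye ℓe q₂-tail
    ... | no _ | yes refl = no-tail ℓy ℓx (apart-sym x-y) q₁-q₂ ℓq₂ xc ℓc q₂-tail
    ... | no q₁≢x | no q₁≢y =
          [ proj₂ x-y , [ (λ x-q₁ → via-q₁ ℓx ℓy x-y xc ℓc ye ℓe x-q₁ q₁≢y)
                        , (λ y-q₁ → via-q₁ ℓy ℓx (apart-sym x-y) ye ℓe xc ℓc y-q₁ q₁≢x) ]′ ]′
            (claw-free v₀ x y q₁ (ℓ≡1⇒adj-root ℓx) (ℓ≡1⇒adj-root ℓy) v₀-q₁ (proj₁ x-y) (q₁≢x ∘ sym) (q₁≢y ∘ sym))

    -- u would be an endpoint of a longest shortest path of smaller degree than v₀: N(u) ∪ {u, o} ⊆ N(v₀) ∪ {v₀}.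
    ¬apart-childless : ∀ {u o} → ℓ u ≡ 1 → ℓ o ≡ 1 → Apart u o → ¬ (∃ λ c → Adj u c × ℓ c ≡ 2) → ⊥
    ¬apart-childless {u} {o} ℓu ℓo (u≢o , ¬uo) childless =
      1+n≰n (≤-trans smaller-degree (min-degree u (diametral⇒endpoint from-u)))
      where
      neighbour-of-root : ∀ {x} → Adj u x → x ≡ v₀ ⊎ Adj v₀ x
      neighbour-of-root {x} ux with ℓ x in ℓx | ℓ-adj ux
      ... | 0 | _ = inj₁ (ℓ≡0⇒root ℓx)
      ... | 1 | _ = inj₂ (ℓ≡1⇒adj-root ℓx)
      ... | 2 | _ = ⊥-elim (childless (x , ux , ℓx))
      ... | suc (suc (suc _)) | ℓx≤ℓu+1 = contradiction (subst (λ k → _ ≤ suc k) ℓu ℓx≤ℓu+1) λ { (s≤s (s≤s ())) }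
      far-from-u : ∀ {m z} → Reach G m u z → z ≡ w₀ → d ≤ m
      far-from-u here u≡w₀ =
        contradiction (subst (2 ≤_) (trans (sym ℓ-w₀) (trans (cong ℓ (sym u≡w₀)) ℓu)) 2≤d) λ { (s≤s ()) }
      far-from-u (step ux r) z≡w₀ with neighbour-of-root ux
      ... | inj₁ refl = ≤-trans (subst (_≤ _) (trans (cong ℓ z≡w₀) ℓ-w₀) (ℓ-minimal r)) (n≤1+n _)
      ... | inj₂ v₀x = subst (_≤ _) (trans (cong ℓ z≡w₀) ℓ-w₀) (ℓ-minimal (step v₀x r))
      from-u : DiametralWalk u
      from-u with reach⇒walk (proj₂ is-diam u w₀)
      ... | m , m≤d , W = record
            { walk = walk-cast (≤-antisym m≤d (far-from-u (walk⇒reach W) refl)) W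
            ; dist = proj₂ is-diam u w₀ , λ _ r → far-from-u r refl
            ; is-diam = is-diam }
      smaller-degree : suc (deg G u) ≤ deg G v₀
      smaller-degree = count-extend (adj? u) (adj? v₀) irrefl ¬uo u≢o cover
        where
        cover : ∀ {x} → Adj u x ⊎ x ≡ u ⊎ x ≡ o → Adj v₀ x ⊎ x ≡ v₀
        cover (inj₁ ux) = [ inj₂ , inj₁ ]′ (neighbour-of-root ux)
        cover (inj₂ (inj₁ refl)) = inj₁ (ℓ≡1⇒adj-root ℓu)
        cover (inj₂ (inj₂ refl)) = inj₁ (ℓ≡1⇒adj-root ℓo)

  clique-one : Clique 1
  clique-one x y ℓx ℓy = equal-or-adjacent λ x-y → apart x-y (has-child? x) (has-child? y)
    where
    has-child? : ∀ u → Dec (∃ λ c → Adj u c × ℓ c ≡ 2)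
    has-child? u = any? λ c → adj? u c ×-dec (ℓ c ≟ 2)
    apart : Apart x y → Dec (∃ λ c → Adj x c × ℓ c ≡ 2) → Dec (∃ λ e → Adj y e × ℓ e ≡ 2) → ⊥
    apart x-y (no childless) _ = ¬apart-childless (diameter≥2 x-y) ℓx ℓy x-y childless
    apart x-y (yes _) (no childless) = ¬apart-childless (diameter≥2 x-y) ℓy ℓx (apart-sym x-y) childless
    apart x-y (yes (c , xc , ℓc)) (yes (e , ye , ℓe)) = ¬apart-with-children (diameter≥2 x-y) ℓx ℓy x-y xc ℓc ye ℓe

  level-clique : ∀ t → Clique t
  level-clique 0 x y ℓx ℓy = inj₁ (trans (ℓ≡0⇒root ℓx) (sym (ℓ≡0⇒root ℓy)))
  level-clique 1 = clique-one
  level-clique (suc (suc k)) = clique-step k (level-clique (suc k))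

  same-level⇒adjacent : ∀ {x y} → ℓ x ≡ ℓ y → x ≡ y ⊎ Adj x y
  same-level⇒adjacent {x} {y} ℓx≡ℓy = level-clique (ℓ y) x y ℓx≡ℓy refl

module Closedness {n : ℕ} (G : Graph n) (connected : Connected G) (chordal : Chordal G)
                  (claw-free : ClawFree G) (narrow : Narrow G) {v₀ : Fin n} (D : Walks.DiametralWalk G v₀)
                  (min-degree : ∀ w → IsLSPEndpoint G w → deg G v₀ ≤ deg G w)
                  {L : List (Fin n)} (I : LabelingInvariant.Invariant G connected v₀ n L) (at-0 : At L 0 v₀) where
  open Graph G renaming (sym to adj-sym)
  open Walks G
  open BreadthFirstLevels G connected v₀
  open InducedCycles G chordal
  open LabelingInvariant G connected v₀
  open Parent
  open Invariant I
  open LevelCliques G connected chordal claw-free narrow D min-degree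
  open import Data.List.Membership.DecPropositional (_≟ᶠ_ {n}) using (_∈?_)

  -- 0-based: the label given to v by the algorithm is label v + 1.
  label : Fin n → ℕ
  label v = proj₁ (∈⇒At (all-labelled I at-0 v))

  at-label : ∀ v → At L (label v) v
  at-label v = proj₂ (∈⇒At (all-labelled I at-0 v))

  label-unique : ∀ {i v} → At L i v → i ≡ label v
  label-unique {v = v} ai = position-unique ai (at-label v)

  label<⇒ℓ≤ : ∀ {x y} → label x < label y → ℓ x ≤ ℓ y
  label<⇒ℓ≤ {x} {y} lt = level-monotone (<⇒≤ lt) (at-label x) (at-label y)

  ℓ<⇒label< : ∀ {x y} → ℓ x < ℓ y → label x < label y
  ℓ<⇒label< {x} {y} lt with label x <? label y
  ... | yes l<l = l<l
  ... | no l≮l = contradiction (level-monotone (≮⇒≥ l≮l) (at-label y) (at-label x)) (<⇒≱ lt)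

  label-positive : ∀ {v} → v ≢ v₀ → 0 < label v
  label-positive {v} v≢v₀ with label v in e
  ... | zero = contradiction (At-functional (subst (λ i → At L i v) e (at-label v)) at-0) v≢v₀
  ... | suc _ = s≤s z≤n

  ∉-take : ∀ {x i} → i ≤ label x → x ∉ take i L
  ∉-take {x} {i} i≤ x∈ with ∈-take⇒At L i x∈
  ... | q , q<i , aq = <⇒≱ (subst (_< i) (label-unique aq) q<i) i≤

  ∉-take⇒≤ : ∀ {x i} → x ∉ take i L → i ≤ label x
  ∉-take⇒≤ {x} {i} x∉ with i ≤? label x
  ... | yes i≤ = i≤
  ... | no i≰ = contradiction (At⇒∈-take (at-label x) (≰⇒> i≰)) x∉

  -- x ≢ a at level ℓ a + 1 not adjacent to a would give the induced 4-cycle a k x b.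
  shared-later-neighbour : ∀ {a b k x} → ℓ a ≡ ℓ b → Adj a b → Adj a k → ℓ k ≡ suc (ℓ a) → ¬ Adj b k →
                           Adj b x → label a ≤ label x → x ≡ a ⊎ Adj a x
  shared-later-neighbour {a} {b} {k} {x} ℓa≡ℓb ab ak ℓk ¬bk bx a≤x with x ≟ᶠ a | <-cmp (ℓ x) (ℓ a)
  ... | yes x≡a | _ = inj₁ x≡a
  ... | no _ | tri< ℓx<ℓa _ _ = contradiction (ℓ<⇒label< ℓx<ℓa) (≤⇒≯ a≤x)
  ... | no x≢a | tri≈ _ ℓx≡ℓa _ = [ inj₁ , inj₂ ∘ adj-sym ]′ (same-level⇒adjacent ℓx≡ℓa)
  ... | no x≢a | tri> _ _ ℓa<ℓx with adj? a x
  ...   | yes ax = inj₂ ax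
  ...   | no ¬ax with same-level⇒adjacent (trans ℓk (sym ℓx))
    where
    ℓx : ℓ x ≡ suc (ℓ a)
    ℓx = ≤-antisym (subst (λ z → ℓ x ≤ suc z) (sym ℓa≡ℓb) (ℓ-adj bx)) ℓa<ℓx
  ...     | inj₁ refl = contradiction bx ¬bk
  ...     | inj₂ kx = ⊥-elim (C4-free ak kx (adj-sym bx) (adj-sym ab) (x≢a ∘ sym , ¬ax)
                                 (≢-by-level ℓk (sym ℓa≡ℓb) 1+n≢n , ¬bk ∘ adj-sym))

  -- Otherwise either a, its parent, b and k form a claw, or b was a strictly better choice than a when a
  -- was picked: N(b)∖J ∪ {k, b} ⊆ N(a)∖J ∪ {a}, with J the vertices labelled before a.
  forward : ∀ {a b k} → ℓ a ≡ ℓ b → label a < label b → Adj a k → ℓ k ≡ suc (ℓ a) → Adj b k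
  forward {a} {b} {k} ℓa≡ℓb a<b ak ℓk with adj? b k
  ... | yes bk = bk
  ... | no ¬bk = ⊥-elim (via-parent (parent (at-label a) (label-positive a≢v₀)))
    where
    a≢b : a ≢ b
    a≢b refl = <-irrefl refl a<b
    a≢v₀ : a ≢ v₀
    a≢v₀ refl = a≢b (sym (ℓ≡0⇒root (trans (sym ℓa≡ℓb) ℓ-root)))
    ab : Adj a b
    ab = ≡⊎adj⇒adj a≢b (same-level⇒adjacent ℓa≡ℓb)
    before-a : List (Fin n)
    before-a = take (label a) L
    b-fewer : suc (outdeg G before-a b) ≤ outdeg G before-a a
    b-fewer = count-extend (λ x → adj? b x ×-dec ¬? (x ∈? before-a)) (λ x → adj? a x ×-dec ¬? (x ∈? before-a))
                (¬bk ∘ proj₁) (irrefl ∘ proj₁) (≢-by-level ℓk (sym ℓa≡ℓb) 1+n≢n) cover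
      where
      cover : ∀ {x} → (Adj b x × x ∉ before-a) ⊎ x ≡ k ⊎ x ≡ b → (Adj a x × x ∉ before-a) ⊎ x ≡ a
      cover (inj₁ (bx , x∉J)) = [ inj₂ , (λ ax → inj₁ (ax , x∉J)) ]′
                                  (shared-later-neighbour ℓa≡ℓb ab ak ℓk ¬bk bx (∉-take⇒≤ x∉J))
      cover (inj₂ (inj₁ refl)) = inj₁ (ak , ∉-take (<⇒≤ (ℓ<⇒label< (subst (ℓ a <_) (sym ℓk) ≤-refl))))
      cover (inj₂ (inj₂ refl)) = inj₁ (ab , ∉-take (<⇒≤ a<b))
    via-parent : PickedBy n L (label a) a → ⊥
    via-parent (P , _ , ℓP , minimal) with adj? (vertex P) b
    ... | yes Pb = 1+n≰n (≤-trans b-fewer (minimal b Pb (∉-take (<⇒≤ a<b))))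
    ... | no ¬Pb = [ ¬Pb , [ proj₂ P-k , ¬bk ]′ ]′
                     (claw-free a (vertex P) b k (adj-sym (adj P)) ab ak
                       (≢-by-level refl (trans (sym ℓa≡ℓb) (sym ℓP)) (1+n≢n ∘ sym)) (proj₁ P-k)
                       (≢-by-level (sym ℓa≡ℓb) ℓk (1+n≢n ∘ sym)))
      where
      P-k : Apart (vertex P) k
      P-k = apart-by-level refl (trans ℓk (cong suc (sym ℓP))) ≤-refl

  -- a's parent is labelled no later than b's parent, which is b's earliest labelled neighbour; so c, on the
  -- level of a's parent, is that parent or labelled after it, and forward applies.
  backward : ∀ {a b c} → ℓ a ≡ ℓ b → label a < label b → Adj b c → suc (ℓ c) ≡ ℓ b → Adj a c
  backward {a} {b} {c} ℓa≡ℓb a<b bc ℓc with adj? a c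
  ... | yes ac = ac
  ... | no ¬ac =
        ⊥-elim (via-parents (parent (at-label a) (label-positive a≢v₀)) (parent (at-label b) (label-positive b≢v₀)))
    where
    b≢v₀ : b ≢ v₀
    b≢v₀ refl = 0≢1+n (trans (sym ℓ-root) (sym ℓc))
    a≢v₀ : a ≢ v₀
    a≢v₀ refl = 0≢1+n (trans (sym ℓ-root) (trans ℓa≡ℓb (sym ℓc)))
    via-parents : PickedBy n L (label a) a → PickedBy n L (label b) b → ⊥
    via-parents (P , _ , ℓP , _) (P′ , _ , _ , _) with <-cmp (label c) (pos P)
    ... | tri< c<P _ _ =
          earliest P′ (<-≤-trans c<P (parent-monotone a<b (at-label a) (at-label b) P P′)) (at-label c) (adj-sym bc)
    ... | tri≈ _ c≡P _ =
          ¬ac (subst (Adj a) (At-functional (at-pos P) (subst (λ i → At L i c) c≡P (at-label c))) (adj-sym (adj P)))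
    ... | tri> _ _ P<c =
          ¬ac (adj-sym (forward ℓP≡ℓc (subst (_< label c) (label-unique (at-pos P)) P<c) (adj P) (sym ℓP)))
      where
      ℓP≡ℓc : ℓ (vertex P) ≡ ℓ c
      ℓP≡ℓc = suc-injective (trans ℓP (trans ℓa≡ℓb (sym ℓc)))

  closed-lower-first : ∀ {a b c} → Adj b a → Adj a c →
                       (label a < label b × label a < label c) ⊎ (label b < label a × label c < label a) →
                       ℓ b < ℓ c → Adj b c
  closed-lower-first {a} {b} {c} ba ac (inj₁ (a<b , a<c)) ℓb<ℓc =
    forward ℓa≡ℓb a<b ac ℓc
    where
    ℓc≤ℓa+1 : ℓ c ≤ suc (ℓ a)
    ℓc≤ℓa+1 = ℓ-adj ac
    ℓa≡ℓb : ℓ a ≡ ℓ b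
    ℓa≡ℓb = ≤-antisym (label<⇒ℓ≤ a<b) (≤-pred (≤-trans ℓb<ℓc ℓc≤ℓa+1))
    ℓc : ℓ c ≡ suc (ℓ a)
    ℓc = ≤-antisym ℓc≤ℓa+1 (subst (_< ℓ c) (sym ℓa≡ℓb) ℓb<ℓc)
  closed-lower-first {a} {b} {c} ba ac (inj₂ (b<a , c<a)) ℓb<ℓc =
    adj-sym (backward ℓc≡ℓa c<a (adj-sym ba) ℓb)
    where
    ℓa≤ℓb+1 : ℓ a ≤ suc (ℓ b)
    ℓa≤ℓb+1 = ℓ-adj ba
    ℓb : suc (ℓ b) ≡ ℓ a
    ℓb = ≤-antisym (≤-trans ℓb<ℓc (label<⇒ℓ≤ c<a)) ℓa≤ℓb+1
    ℓc≡ℓa : ℓ c ≡ ℓ a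
    ℓc≡ℓa = ≤-antisym (label<⇒ℓ≤ c<a) (subst (_≤ ℓ c) ℓb ℓb<ℓc)

  closed : ClosedOrder G L
  closed {i} {j} {k} {a} {b} {c} ai bj ck j≢k ba ac order
    rewrite label-unique ai | label-unique bj | label-unique ck with <-cmp (ℓ b) (ℓ c)
  ... | tri< ℓb<ℓc _ _ = closed-lower-first ba ac order ℓb<ℓc
  ... | tri≈ _ ℓb≡ℓc _ = ≡⊎adj⇒adj (j≢k ∘ cong label) (same-level⇒adjacent ℓb≡ℓc)
  ... | tri> _ _ ℓc<ℓb = adj-sym (closed-lower-first (adj-sym ac) (adj-sym ba) (⊎-map swap swap order) ℓc<ℓb)

root : ∀ {n} {G : Graph n} {j L} → AlgState G j L →
       ∃ λ v₀ → At L 0 v₀ × IsLSPEndpoint G v₀ × (∀ w → IsLSPEndpoint G w → deg G v₀ ≤ deg G w)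
root (start v₀ endpoint min-degree) = v₀ , at-here , endpoint , min-degree
root (pick s _ _ _ _) = let v₀ , at-0 , rest = root s in v₀ , At-++⁺ˡ at-0 , rest
root (next s _ _) = root s

theorem4p1 : ∀ {n : ℕ} (G : Graph n) → Connected G → Chordal G → ClawFree G →
             Narrow G → (L : List (Fin n)) → AlgOutput G L → ClosedOrder G L
theorem4p1 G connected chordal claw-free narrow L output with root output
... | v₀ , at-0 , endpoint , min-degree =
  Closedness.closed G connected chordal claw-free narrow (Walks.endpoint⇒diametral G endpoint) min-degree
    (LabelingInvariant.invariant G connected v₀ output at-0) at-0
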